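{- Let $g(x)=\sum_{n\ge 1}\frac{2\,(4n+1)!}{(n+1)!\,(3n+2)!}\,x^n$ be a formal power series, and for integers $n\ge1$ and $r\ge 2$ define $A_r(n)=\frac{[x^n](g(x))^r}{[x^n]g(x)}$ and $B_r=\lim_{n\to\infty}A_r(n)$. Then for all integers $n\ge 1$, $$A_3(n)=\frac{5(n-1)(n-2)\left(5n^4+160n^3+1803n^2+3768n+2016\right)}{3(3n+8)(3n+5)(3n+7)(3n+4)(n+3)(n+2)},$$ $$A_4(n)=\frac{20(n-1)(n-2)(n-3)\left(25n^6+1350n^5+31495n^4+347406n^3+1211092n^2+1580304n+665280\right)}{27(3n+11)(3n+8)(3n+5)(3n+10)(3n+7)(3n+4)(n+4)(n+3)(n+2)},$$ and consequently the limits exist with $B_3=\frac{25}{243}$ and $B_4=\frac{500}{19683}$.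
   Context: For a formal power series $f(x)$, $[x^n]f(x)$ denotes the coefficient of $x^n$ in $f(x)$. -}

module Defs where

open import Data.Nat as ℕ using (ℕ; zero; suc; _!)
open import Data.Integer as ℤ using (ℤ)
open import Data.Rational using (ℚ; 0ℚ; 1ℚ; _+_; _*_; _-_; _÷_; ∣_∣; _<_; ≢-nonZero)
open import Data.Rational.Properties using (_≟_)
open import Data.Product using (∃)
open import Relation.Nullary using (yes; no)

⟦_⟧ : ℕ → ℚ
⟦ n ⟧ = ℤ.+ n Data.Rational./ 1

-- total division on ℚ (x / 0 := 0); only ever used with nonzero divisors below
_÷'_ : ℚ → ℚ → ℚ
p ÷' q with q ≟ 0ℚ
... | yes _ = 0ℚ
... | no q≢0 = _÷_ p q {{≢-nonZero q≢0}}

infixl 7 _÷'_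

gCoeff : ℕ → ℚ
gCoeff zero = 0ℚ
gCoeff n@(suc _) =
  ⟦ 2 ℕ.* (4 ℕ.* n ℕ.+ 1) ! ⟧ ÷' ⟦ (n ℕ.+ 1) ! ℕ.* (3 ℕ.* n ℕ.+ 2) ! ⟧

sumTo : ℕ → (ℕ → ℚ) → ℚ
sumTo zero f = f 0
sumTo (suc n) f = sumTo n f + f (suc n)

gPowCoeff : ℕ → ℕ → ℚ
gPowCoeff zero zero = 1ℚ
gPowCoeff zero (suc _) = 0ℚ
gPowCoeff (suc r) n = sumTo n (λ k → gCoeff k * gPowCoeff r (n ℕ.∸ k))

A : ℕ → ℕ → ℚ
A r n = gPowCoeff r n ÷' gCoeff n

ConvergesTo : (ℕ → ℚ) → ℚ → Set
ConvergesTo a L = ∀ (ε : ℚ) → 0ℚ < ε → ∃ λ N → ∀ n → N ℕ.≤ n → ∣ a n - L ∣ < ε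

A3formula : ℕ → ℚ
A3formula n =
  (⟦ 5 ⟧ * (x - ⟦ 1 ⟧) * (x - ⟦ 2 ⟧)
     * (⟦ 5 ⟧ * x * x * x * x + ⟦ 160 ⟧ * x * x * x + ⟦ 1803 ⟧ * x * x + ⟦ 3768 ⟧ * x + ⟦ 2016 ⟧))
  ÷' (⟦ 3 ⟧ * (⟦ 3 ⟧ * x + ⟦ 8 ⟧) * (⟦ 3 ⟧ * x + ⟦ 5 ⟧) * (⟦ 3 ⟧ * x + ⟦ 7 ⟧) * (⟦ 3 ⟧ * x + ⟦ 4 ⟧)
       * (x + ⟦ 3 ⟧) * (x + ⟦ 2 ⟧))
  where x = ⟦ n ⟧

A4formula : ℕ → ℚ
A4formula n =
  (⟦ 20 ⟧ * (x - ⟦ 1 ⟧) * (x - ⟦ 2 ⟧) * (x - ⟦ 3 ⟧)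
     * (⟦ 25 ⟧ * x * x * x * x * x * x + ⟦ 1350 ⟧ * x * x * x * x * x + ⟦ 31495 ⟧ * x * x * x * x
        + ⟦ 347406 ⟧ * x * x * x + ⟦ 1211092 ⟧ * x * x + ⟦ 1580304 ⟧ * x + ⟦ 665280 ⟧))
  ÷' (⟦ 27 ⟧ * (⟦ 3 ⟧ * x + ⟦ 11 ⟧) * (⟦ 3 ⟧ * x + ⟦ 8 ⟧) * (⟦ 3 ⟧ * x + ⟦ 5 ⟧) * (⟦ 3 ⟧ * x + ⟦ 10 ⟧)
       * (⟦ 3 ⟧ * x + ⟦ 7 ⟧) * (⟦ 3 ⟧ * x + ⟦ 4 ⟧) * (x + ⟦ 4 ⟧) * (x + ⟦ 3 ⟧) * (x + ⟦ 2 ⟧))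
  where x = ⟦ n ⟧

{-# OPTIONS --safe #-}

-- Let B = 1 + x B⁴, so that [x^m] B^a is the Fuss–Catalan number a/(4m + a) · C(4m + a, m).
-- The recurrence B^(a+1) = B^a + x B^(a+4) gives B^a B^b = B^(a+b) by induction, and
-- g = x B⁴ (1 + B - B²); hence g^r = x^r B^(4r) (1 + B - B²)^r and [x^n] g^r is an explicit integer
-- combination of Fuss–Catalan numbers. Writing n = r + m, each of these and [x^n] g is a polynomial
-- in m times the common factor (4m + 4r - 1)! / ((m + r + 1)! (3m + 6r)!), so A_r(n) is a ratio
-- of two polynomials in m, and the stated formulas for r = 3, 4 are polynomial identities.
-- For the limits, |A_r(n) - lim A_r| ≤ K/n is, after clearing denominators, the nonnegativity of
-- two polynomials in n - 1, which have nonnegative coefficients.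
module Submission where

open import Defs
open import Data.Nat as ℕ using (ℕ; zero; suc; _!; _∸_; z≤n; s≤s)
import Data.Nat.Properties as ℕP
import Data.Nat.Tactic.RingSolver as ℕ-Solver
open import Data.Integer as ℤ using (ℤ; +_)
import Data.Integer.Properties as ℤP
import Data.Integer.Tactic.RingSolver as ℤ-Solver
open import Data.Rational as ℚ using (ℚ; mkℚ; 0ℚ; 1ℚ; _+_; _*_; _-_; -_; _/_; ∣_∣; _<_; _≤_)
import Data.Rational.Properties as ℚP
import Data.Rational.Unnormalised as ℚᵘ
import Data.Rational.Unnormalised.Properties as ℚᵘP
open import Data.List as List using (List; []; _∷_; length)
open import Data.List.Properties using (length-map)
open import Data.Vec using (_∷_; [])
import Data.Fin as Fin
open import Data.Maybe using (Maybe; just; nothing)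
open import Data.Product using (_×_; _,_)
open import Data.Sum using (_⊎_; inj₁; inj₂)
open import Data.Empty using (⊥-elim)
open import Relation.Nullary using (yes; no)
open import Relation.Binary.PropositionalEquality
import Algebra.Solver.Ring
import Algebra.Solver.Ring.AlmostCommutativeRing as ACR
open import Tactic.RingSolver using (solve-∀)
import Tactic.RingSolver.Core.AlmostCommutativeRing as TACR
open import Level using (0ℓ)
open ≡-Reasoning

ι : ℤ → ℚ
ι i = i / 1

private
  ι-toℚᵘ : ∀ i → ℚ.toℚᵘ (ι i) ℚᵘ.≃ ℚᵘ.mkℚᵘ i 0
  ι-toℚᵘ i = ℚP.toℚᵘ-fromℚᵘ (ℚᵘ.mkℚᵘ i 0)

ι-+ : ∀ i j → ι (i ℤ.+ j) ≡ ι i + ι j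
ι-+ i j = ℚP.toℚᵘ-injective (ℚᵘP.≃-trans (ι-toℚᵘ (i ℤ.+ j)) (ℚᵘP.≃-sym (ℚᵘP.≃-trans
  (ℚP.toℚᵘ-homo-+ (ι i) (ι j)) (ℚᵘP.≃-trans (ℚᵘP.+-cong (ι-toℚᵘ i) (ι-toℚᵘ j)) (ℚᵘ.*≡* (eq i j))))))
  where
  eq : ∀ i j → ((i ℤ.* + 1) ℤ.+ (j ℤ.* + 1)) ℤ.* + 1 ≡ (i ℤ.+ j) ℤ.* + 1
  eq = ℤ-Solver.solve-∀

ι-* : ∀ i j → ι (i ℤ.* j) ≡ ι i * ι j
ι-* i j = ℚP.toℚᵘ-injective (ℚᵘP.≃-trans (ι-toℚᵘ (i ℤ.* j)) (ℚᵘP.≃-sym (ℚᵘP.≃-trans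
  (ℚP.toℚᵘ-homo-* (ι i) (ι j)) (ℚᵘP.*-cong (ι-toℚᵘ i) (ι-toℚᵘ j)))))

ι-neg : ∀ i → ι (ℤ.- i) ≡ - ι i
ι-neg i = ℚP.toℚᵘ-injective (ℚᵘP.≃-trans (ι-toℚᵘ (ℤ.- i)) (ℚᵘP.≃-sym (ℚᵘP.≃-trans
  (ℚP.toℚᵘ-homo‿- (ι i)) (ℚᵘP.-‿cong (ι-toℚᵘ i)))))

ι-injective : ∀ {i j} → ι i ≡ ι j → i ≡ j
ι-injective {i} {j} eq with ℚᵘP.≃-trans (ℚᵘP.≃-sym (ι-toℚᵘ i)) (ℚᵘP.≃-trans (ℚP.toℚᵘ-cong eq) (ι-toℚᵘ j))
... | ℚᵘ.*≡* e = trans (sym (ℤP.*-identityʳ i)) (trans e (ℤP.*-identityʳ j))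

⟦⟧-+ : ∀ m n → ⟦ m ℕ.+ n ⟧ ≡ ⟦ m ⟧ + ⟦ n ⟧
⟦⟧-+ m n = ι-+ (+ m) (+ n)

⟦⟧-* : ∀ m n → ⟦ m ℕ.* n ⟧ ≡ ⟦ m ⟧ * ⟦ n ⟧
⟦⟧-* m n = trans (cong ι (ℤP.pos-* m n)) (ι-* (+ m) (+ n))

⟦⟧-nonZero : ∀ n → n ≢ 0 → ⟦ n ⟧ ≢ 0ℚ
⟦⟧-nonZero n n≢0 eq = n≢0 (ℤP.+-injective (ι-injective eq))

⟦suc⟧≢0 : ∀ n → ⟦ suc n ⟧ ≢ 0ℚ
⟦suc⟧≢0 n = ⟦⟧-nonZero (suc n) (λ ())

⟦⟧-nonNeg : ∀ n → 0ℚ ≤ ⟦ n ⟧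
⟦⟧-nonNeg n = ℚP.nonNegative⁻¹ ⟦ n ⟧ {{ℚP.normalize-nonNeg n 1}}

0<⟦suc⟧ : ∀ n → 0ℚ < ⟦ suc n ⟧
0<⟦suc⟧ n = ℚP.positive⁻¹ ⟦ suc n ⟧ {{ℚP.normalize-pos (suc n) 1}}

⟦suc⟧≡+1 : ∀ k → ⟦ suc k ⟧ ≡ ⟦ k ⟧ + ⟦ 1 ⟧
⟦suc⟧≡+1 k = trans (cong ⟦_⟧ (ℕP.+-comm 1 k)) (⟦⟧-+ k 1)

ℚ-ring : TACR.AlmostCommutativeRing 0ℓ 0ℓ
ℚ-ring = TACR.fromCommutativeRing ℚP.+-*-commutativeRing 0≟
  where
  0≟ : ∀ q → Maybe (0ℚ ≡ q)
  0≟ q with 0ℚ ℚP.≟ q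
  ... | yes 0≡q = just 0≡q
  ... | no _ = nothing

ι-morphism : ℤ.+-*-rawRing ACR.-Raw-AlmostCommutative⟶ ACR.fromCommutativeRing ℚP.+-*-commutativeRing
ι-morphism = record
  { ⟦_⟧ = ι ; +-homo = ι-+ ; *-homo = ι-* ; -‿homo = ι-neg ; 0-homo = refl ; 1-homo = refl }

ι-coeff? : ∀ i j → Maybe (ι i ≡ ι j)
ι-coeff? i j with i ℤ.≟ j
... | yes i≡j = just (cong ι i≡j)
... | no _ = nothing

-- The reflective solver over ℚ-ring normalises with rational coefficient arithmetic, which is far
-- too slow for the large identities below; this one keeps the coefficients in ℤ.
module ℚ[ℤ] = Algebra.Solver.Ring
  ℤ.+-*-rawRing (ACR.fromCommutativeRing ℚP.+-*-commutativeRing) ι-morphism ι-coeff?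

infixl 7 _·⁺_

_·⁺_ : ∀ {p q} → 0ℚ < p → 0ℚ < q → 0ℚ < p * q
_·⁺_ {p} {q} 0<p 0<q =
  ℚP.positive⁻¹ (p * q) {{ℚP.pos*pos⇒pos p {{ℚ.positive 0<p}} q {{ℚ.positive 0<q}}}}

*-nonNeg : ∀ {p q} → 0ℚ ≤ p → 0ℚ ≤ q → 0ℚ ≤ p * q
*-nonNeg {p} {q} 0≤p 0≤q =
  ℚP.nonNegative⁻¹ (p * q) {{ℚP.nonNeg*nonNeg⇒nonNeg p {{ℚ.nonNegative 0≤p}} q {{ℚ.nonNegative 0≤q}}}}

+⟦suc⟧-pos : ∀ d {y} → 0ℚ ≤ y → 0ℚ < y + ⟦ suc d ⟧
+⟦suc⟧-pos d 0≤y = ℚP.+-mono-≤-< 0≤y (0<⟦suc⟧ d)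

affine-pos : ∀ c d {y} → 0ℚ ≤ y → 0ℚ < ⟦ c ⟧ * y + ⟦ suc d ⟧
affine-pos c d 0≤y = +⟦suc⟧-pos d (*-nonNeg (⟦⟧-nonNeg c) 0≤y)

pos⇒≢0 : ∀ {p} → 0ℚ < p → p ≢ 0ℚ
pos⇒≢0 0<p p≡0 = ℚP.<-irrefl (sym p≡0) 0<p

0≤q-p⇒p≤q : ∀ {p q} → 0ℚ ≤ q - p → p ≤ q
0≤q-p⇒p≤q {p} {q} 0≤q-p = subst₂ _≤_ (ℚP.+-identityˡ p) (cancel q p) (ℚP.+-monoˡ-≤ p 0≤q-p)
  where
  cancel : ∀ q p → q - p + p ≡ q
  cancel = solve-∀ ℚ-ring

0≤q∓p⇒∣p∣≤q : ∀ {p q} → 0ℚ ≤ q - p → 0ℚ ≤ q + p → ∣ p ∣ ≤ q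
0≤q∓p⇒∣p∣≤q {p} {q} 0≤q-p 0≤q+p with ℚP.∣p∣≡p∨∣p∣≡-p p
... | inj₁ ∣p∣≡p = subst (_≤ q) (sym ∣p∣≡p) (0≤q-p⇒p≤q 0≤q-p)
... | inj₂ ∣p∣≡-p = subst (_≤ q) (sym ∣p∣≡-p) (0≤q-p⇒p≤q (subst (0ℚ ≤_) (double-neg q p) 0≤q+p))
  where
  double-neg : ∀ q p → q + p ≡ q - - p
  double-neg = solve-∀ ℚ-ring

0≤p*q⇒0≤p : ∀ {p q} → 0ℚ < q → 0ℚ ≤ p * q → 0ℚ ≤ p
0≤p*q⇒0≤p {p} {q} 0<q 0≤pq =
  ℚP.*-cancelʳ-≤-pos q {{ℚ.positive 0<q}} (subst (_≤ p * q) (sym (ℚP.*-zeroˡ q)) 0≤pq)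

inv : ℚ → ℚ
inv q = 1ℚ ÷' q

÷'-≡-*inv : ∀ p q → p ÷' q ≡ p * inv q
÷'-≡-*inv p q with q ℚP.≟ 0ℚ
... | yes _ = sym (ℚP.*-zeroʳ p)
... | no _ = cong (p *_) (sym (ℚP.*-identityˡ _))

inv-inverseʳ : ∀ {q} → q ≢ 0ℚ → q * inv q ≡ 1ℚ
inv-inverseʳ {q} q≢0 with q ℚP.≟ 0ℚ
... | yes q≡0 = ⊥-elim (q≢0 q≡0)
... | no q≢0 = trans (cong (q *_) (ℚP.*-identityˡ _)) (ℚP.*-inverseʳ q {{ℚ.≢-nonZero q≢0}})

inv-zero : ∀ q → q ≡ 0ℚ → inv q ≡ 0ℚ
inv-zero q q≡0 with q ℚP.≟ 0ℚ
... | yes _ = refl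
... | no q≢0 = ⊥-elim (q≢0 q≡0)

*-≢0 : ∀ {p q} → p ≢ 0ℚ → q ≢ 0ℚ → p * q ≢ 0ℚ
*-≢0 {p} {q} p≢0 q≢0 pq≡0 = ℚP.1≢0 (begin
  1ℚ                        ≡⟨ sym (cong₂ _*_ (inv-inverseʳ p≢0) (inv-inverseʳ q≢0)) ⟩
  (p * inv p) * (q * inv q) ≡⟨ regroup p (inv p) q (inv q) ⟩
  (p * q) * (inv p * inv q) ≡⟨ cong (_* (inv p * inv q)) pq≡0 ⟩
  0ℚ * (inv p * inv q)      ≡⟨ ℚP.*-zeroˡ (inv p * inv q) ⟩
  0ℚ                        ∎)
  where
  regroup : ∀ a b c d → (a * b) * (c * d) ≡ (a * c) * (b * d)
  regroup = solve-∀ ℚ-ring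

inv-unique : ∀ q r → q * r ≡ 1ℚ → inv q ≡ r
inv-unique q r qr≡1 = begin
  inv q             ≡⟨ sym (ℚP.*-identityʳ _) ⟩
  inv q * 1ℚ        ≡⟨ cong (inv q *_) (sym qr≡1) ⟩
  inv q * (q * r)   ≡⟨ sym (ℚP.*-assoc (inv q) q r) ⟩
  (inv q * q) * r   ≡⟨ cong (_* r) (trans (ℚP.*-comm (inv q) q) (inv-inverseʳ q≢0)) ⟩
  1ℚ * r            ≡⟨ ℚP.*-identityˡ r ⟩
  r                 ∎
  where
  q≢0 : q ≢ 0ℚ
  q≢0 q≡0 = ℚP.1≢0 (trans (sym qr≡1) (trans (cong (_* r) q≡0) (ℚP.*-zeroˡ r)))

≡0⊎≢0 : ∀ q → q ≡ 0ℚ ⊎ q ≢ 0ℚ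
≡0⊎≢0 q with q ℚP.≟ 0ℚ
... | yes q≡0 = inj₁ q≡0
... | no q≢0 = inj₂ q≢0

inv-* : ∀ p q → inv (p * q) ≡ inv p * inv q
inv-* p q with ≡0⊎≢0 p | ≡0⊎≢0 q
... | inj₁ p≡0 | _ = trans (inv-zero (p * q) (trans (cong (_* q) p≡0) (ℚP.*-zeroˡ q)))
                           (sym (trans (cong (_* inv q) (inv-zero p p≡0)) (ℚP.*-zeroˡ (inv q))))
... | inj₂ _ | inj₁ q≡0 = trans (inv-zero (p * q) (trans (cong (p *_) q≡0) (ℚP.*-zeroʳ p)))
                                (sym (trans (cong (inv p *_) (inv-zero q q≡0)) (ℚP.*-zeroʳ (inv p))))
... | inj₂ p≢0 | inj₂ q≢0 = inv-unique (p * q) (inv p * inv q) (begin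
  (p * q) * (inv p * inv q) ≡⟨ regroup p q (inv p) (inv q) ⟩
  (p * inv p) * (q * inv q) ≡⟨ cong₂ _*_ (inv-inverseʳ p≢0) (inv-inverseʳ q≢0) ⟩
  1ℚ * 1ℚ                   ≡⟨ ℚP.*-identityˡ 1ℚ ⟩
  1ℚ                        ∎)
  where
  regroup : ∀ a b c d → (a * b) * (c * d) ≡ (a * c) * (b * d)
  regroup = solve-∀ ℚ-ring

0÷' : ∀ q → 0ℚ ÷' q ≡ 0ℚ
0÷' q = trans (÷'-≡-*inv 0ℚ q) (ℚP.*-zeroˡ (inv q))

÷'-cross : ∀ {p q r s} → q ≢ 0ℚ → s ≢ 0ℚ → p * s ≡ r * q → p ÷' q ≡ r ÷' s
÷'-cross {p} {q} {r} {s} q≢0 s≢0 ps≡rq = begin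
  p ÷' q
    ≡⟨ ÷'-≡-*inv p q ⟩
  p * inv q
    ≡⟨ sym (trans (cong (p * inv q *_) (inv-inverseʳ s≢0)) (ℚP.*-identityʳ _)) ⟩
  p * inv q * (s * inv s)
    ≡⟨ regroup p (inv q) s (inv s) ⟩
  (p * s) * (inv q * inv s)
    ≡⟨ cong (_* (inv q * inv s)) ps≡rq ⟩
  (r * q) * (inv q * inv s)
    ≡⟨ regroup' r q (inv q) (inv s) ⟩
  r * inv s * (q * inv q)
    ≡⟨ trans (cong (r * inv s *_) (inv-inverseʳ q≢0)) (ℚP.*-identityʳ _) ⟩
  r * inv s
    ≡⟨ sym (÷'-≡-*inv r s) ⟩
  r ÷' s ∎
  where
  regroup : ∀ a b c d → a * b * (c * d) ≡ (a * c) * (b * d)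
  regroup = solve-∀ ℚ-ring
  regroup' : ∀ a b c d → (a * b) * (c * d) ≡ a * d * (b * c)
  regroup' = solve-∀ ℚ-ring

÷'-*-cancel : ∀ p q → q ≢ 0ℚ → (p ÷' q) * q ≡ p
÷'-*-cancel p q q≢0 = begin
  (p ÷' q) * q     ≡⟨ cong (_* q) (÷'-≡-*inv p q) ⟩
  p * inv q * q    ≡⟨ ℚP.*-assoc p (inv q) q ⟩
  p * (inv q * q)  ≡⟨ cong (p *_) (trans (ℚP.*-comm (inv q) q) (inv-inverseʳ q≢0)) ⟩
  p * 1ℚ           ≡⟨ ℚP.*-identityʳ p ⟩
  p                ∎

÷'-cancelʳ : ∀ p q h → q * h ≢ 0ℚ → (p * h) ÷' (q * h) ≡ p ÷' q
÷'-cancelʳ p q h qh≢0 = ÷'-cross qh≢0 q≢0 (regroup p h q)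
  where
  q≢0 : q ≢ 0ℚ
  q≢0 q≡0 = qh≢0 (trans (cong (_* h) q≡0) (ℚP.*-zeroˡ h))
  regroup : ∀ p h q → p * h * q ≡ p * (q * h)
  regroup = solve-∀ ℚ-ring

cong₃ : ∀ {A B C D : Set} (f : A → B → C → D) {x x' y y' z z'} → x ≡ x' → y ≡ y' → z ≡ z' → f x y z ≡ f x' y' z'
cong₃ f refl refl refl = refl

-- Power series coefficients and the Cauchy product

sumTo-cong : ∀ n {f h : ℕ → ℚ} → (∀ k → k ℕ.≤ n → f k ≡ h k) → sumTo n f ≡ sumTo n h
sumTo-cong zero f≡h = f≡h 0 z≤n
sumTo-cong (suc n) f≡h =
  cong₂ _+_ (sumTo-cong n (λ k k≤n → f≡h k (ℕP.m≤n⇒m≤1+n k≤n))) (f≡h (suc n) ℕP.≤-refl)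

sumTo-+ : ∀ n (f h : ℕ → ℚ) → sumTo n (λ k → f k + h k) ≡ sumTo n f + sumTo n h
sumTo-+ zero f h = refl
sumTo-+ (suc n) f h = trans (cong (_+ (f (suc n) + h (suc n))) (sumTo-+ n f h))
  (interchange (sumTo n f) (sumTo n h) (f (suc n)) (h (suc n)))
  where
  interchange : ∀ a b c d → (a + b) + (c + d) ≡ (a + c) + (b + d)
  interchange = solve-∀ ℚ-ring

sumTo-* : ∀ n c (f : ℕ → ℚ) → sumTo n (λ k → c * f k) ≡ c * sumTo n f
sumTo-* zero c f = refl
sumTo-* (suc n) c f = trans (cong (_+ (c * f (suc n))) (sumTo-* n c f))
  (sym (ℚP.*-distribˡ-+ c (sumTo n f) (f (suc n))))

sumTo-zero : ∀ n (f : ℕ → ℚ) → (∀ k → f k ≡ 0ℚ) → sumTo n f ≡ 0ℚ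
sumTo-zero zero f f≡0 = f≡0 0
sumTo-zero (suc n) f f≡0 = cong₂ _+_ (sumTo-zero n f f≡0) (f≡0 (suc n))

sumTo-suc : ∀ n (f : ℕ → ℚ) → sumTo (suc n) f ≡ f 0 + sumTo n (λ k → f (suc k))
sumTo-suc zero f = refl
sumTo-suc (suc n) f = trans (cong (_+ f (suc (suc n))) (sumTo-suc n f)) (ℚP.+-assoc (f 0) _ _)

infixl 7 _⋆_

_⋆_ : (ℕ → ℚ) → (ℕ → ℚ) → ℕ → ℚ
(f ⋆ h) n = sumTo n (λ k → f k * h (n ∸ k))

shift : ℕ → (ℕ → ℚ) → ℕ → ℚ
shift zero f n = f n
shift (suc r) f zero = 0ℚ
shift (suc r) f (suc n) = shift r f n

shift-cong : ∀ r {f h : ℕ → ℚ} → (∀ k → f k ≡ h k) → ∀ n → shift r f n ≡ shift r h n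
shift-cong zero f≡h n = f≡h n
shift-cong (suc r) f≡h zero = refl
shift-cong (suc r) f≡h (suc n) = shift-cong r f≡h n

shift-+ : ∀ r (f : ℕ → ℚ) m → shift r f (r ℕ.+ m) ≡ f m
shift-+ zero f m = refl
shift-+ (suc r) f m = shift-+ r f m

shift-below : ∀ r (f : ℕ → ℚ) n → n ℕ.< r → shift r f n ≡ 0ℚ
shift-below (suc r) f zero _ = refl
shift-below (suc r) f (suc n) (s≤s n<r) = shift-below r f n n<r

⋆-cong : ∀ {f f' h h' : ℕ → ℚ} → (∀ k → f k ≡ f' k) → (∀ k → h k ≡ h' k) → ∀ n → (f ⋆ h) n ≡ (f' ⋆ h') n
⋆-cong f≡f' h≡h' n = sumTo-cong n (λ k _ → cong₂ _*_ (f≡f' k) (h≡h' (n ∸ k)))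

⋆-distribʳ-+ : ∀ (f g h : ℕ → ℚ) n → ((λ k → f k + g k) ⋆ h) n ≡ (f ⋆ h) n + (g ⋆ h) n
⋆-distribʳ-+ f g h n = trans (sumTo-cong n (λ k _ → ℚP.*-distribʳ-+ (h (n ∸ k)) (f k) (g k))) (sumTo-+ n _ _)

⋆-distribˡ-+ : ∀ (f g h : ℕ → ℚ) n → (h ⋆ (λ k → f k + g k)) n ≡ (h ⋆ f) n + (h ⋆ g) n
⋆-distribˡ-+ f g h n = trans (sumTo-cong n (λ k _ → ℚP.*-distribˡ-+ (h k) (f (n ∸ k)) (g (n ∸ k)))) (sumTo-+ n _ _)

⋆-scaleˡ : ∀ c (f h : ℕ → ℚ) n → ((λ k → c * f k) ⋆ h) n ≡ c * (f ⋆ h) n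
⋆-scaleˡ c f h n = trans (sumTo-cong n (λ k _ → ℚP.*-assoc c (f k) (h (n ∸ k)))) (sumTo-* n c _)

⋆-scaleʳ : ∀ c (f h : ℕ → ℚ) n → (h ⋆ (λ k → c * f k)) n ≡ c * (h ⋆ f) n
⋆-scaleʳ c f h n = trans (sumTo-cong n (λ k _ → swap (h k) c (f (n ∸ k)))) (sumTo-* n c _)
  where
  swap : ∀ a b c → a * (b * c) ≡ b * (a * c)
  swap = solve-∀ ℚ-ring

⋆-zeroˡ : ∀ (h : ℕ → ℚ) n → ((λ _ → 0ℚ) ⋆ h) n ≡ 0ℚ
⋆-zeroˡ h n = sumTo-zero n _ (λ k → ℚP.*-zeroˡ (h (n ∸ k)))

⋆-zeroʳ : ∀ (h : ℕ → ℚ) n → (h ⋆ (λ _ → 0ℚ)) n ≡ 0ℚ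
⋆-zeroʳ h n = sumTo-zero n _ (λ k → ℚP.*-zeroʳ (h k))

shift-⋆ : ∀ (f h : ℕ → ℚ) n → (shift 1 f ⋆ h) (suc n) ≡ (f ⋆ h) n
shift-⋆ f h n = trans (sumTo-suc n _)
  (trans (cong (_+ (f ⋆ h) n) (ℚP.*-zeroˡ (h (suc n)))) (ℚP.+-identityˡ _))

⋆-shift : ∀ (f h : ℕ → ℚ) n → (f ⋆ shift 1 h) (suc n) ≡ (f ⋆ h) n
⋆-shift f h n = trans (cong₂ _+_ (sumTo-cong n index-shift) last-vanishes) (ℚP.+-identityʳ _)
  where
  index-shift : ∀ k → k ℕ.≤ n → f k * shift 1 h (suc n ∸ k) ≡ f k * h (n ∸ k)
  index-shift k k≤n = cong (λ i → f k * shift 1 h i) (ℕP.+-∸-assoc 1 k≤n)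
  last-vanishes : f (suc n) * shift 1 h (suc n ∸ suc n) ≡ 0ℚ
  last-vanishes = trans (cong (λ i → f (suc n) * shift 1 h i) (ℕP.n∸n≡0 n)) (ℚP.*-zeroʳ (f (suc n)))

shift-⋆-shift : ∀ r (f h : ℕ → ℚ) n → (shift 1 f ⋆ shift r h) n ≡ shift (suc r) (f ⋆ h) n
shift-⋆-shift zero f h zero = ℚP.*-zeroˡ (h 0)
shift-⋆-shift zero f h (suc n) = shift-⋆ f h n
shift-⋆-shift (suc r) f h zero = ℚP.*-zeroʳ 0ℚ
shift-⋆-shift (suc r) f h (suc n) = begin
  (shift 1 f ⋆ shift (suc r) h) (suc n)
    ≡⟨ ⋆-cong {f = shift 1 f} (λ _ → refl) (shift-suc r h) (suc n) ⟩
  (shift 1 f ⋆ shift 1 (shift r h)) (suc n)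
    ≡⟨ ⋆-shift (shift 1 f) (shift r h) n ⟩
  (shift 1 f ⋆ shift r h) n
    ≡⟨ shift-⋆-shift r f h n ⟩
  shift (suc r) (f ⋆ h) n ∎
  where
  shift-suc : ∀ r (f : ℕ → ℚ) k → shift (suc r) f k ≡ shift 1 (shift r f) k
  shift-suc r f zero = refl
  shift-suc r f (suc k) = refl

fact : ℕ → ℚ
fact t = ⟦ t ! ⟧

fact⁻¹ : ℕ → ℚ
fact⁻¹ t = inv (fact t)

fact≢0 : ∀ t → fact t ≢ 0ℚ
fact≢0 t = ⟦⟧-nonZero (t !) (ℕ.≢-nonZero⁻¹ (t !) {{t ℕP.!≢0}})

fact⁻¹≢0 : ∀ t → fact⁻¹ t ≢ 0ℚ
fact⁻¹≢0 t inv≡0 = ℚP.1≢0 (trans (sym (inv-inverseʳ (fact≢0 t))) (trans (cong (fact t *_) inv≡0) (ℚP.*-zeroʳ (fact t))))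

fact-suc : ∀ t → fact (suc t) ≡ ⟦ suc t ⟧ * fact t
fact-suc t = ⟦⟧-* (suc t) (t !)

fact⁻¹-suc : ∀ t → fact⁻¹ t ≡ ⟦ suc t ⟧ * fact⁻¹ (suc t)
fact⁻¹-suc t = begin
  fact⁻¹ t
    ≡⟨ sym (ℚP.*-identityʳ _) ⟩
  fact⁻¹ t * 1ℚ
    ≡⟨ cong (fact⁻¹ t *_) (sym (inv-inverseʳ (fact≢0 (suc t)))) ⟩
  fact⁻¹ t * (fact (suc t) * fact⁻¹ (suc t))
    ≡⟨ cong (λ x → fact⁻¹ t * (x * fact⁻¹ (suc t))) (fact-suc t) ⟩
  fact⁻¹ t * (⟦ suc t ⟧ * fact t * fact⁻¹ (suc t))
    ≡⟨ regroup (fact⁻¹ t) ⟦ suc t ⟧ (fact t) (fact⁻¹ (suc t)) ⟩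
  ⟦ suc t ⟧ * fact⁻¹ (suc t) * (fact t * fact⁻¹ t)
    ≡⟨ cong (⟦ suc t ⟧ * fact⁻¹ (suc t) *_) (inv-inverseʳ (fact≢0 t)) ⟩
  ⟦ suc t ⟧ * fact⁻¹ (suc t) * 1ℚ
    ≡⟨ ℚP.*-identityʳ _ ⟩
  ⟦ suc t ⟧ * fact⁻¹ (suc t) ∎
  where
  regroup : ∀ a b c d → a * (b * c * d) ≡ b * d * (c * a)
  regroup = solve-∀ ℚ-ring

-- (x + 1)(x + 2)⋯(x + j), so that (t + j)! = rise t j · t!
rise : ℚ → ℕ → ℚ
rise x zero = 1ℚ
rise x (suc j) = rise x j * (x + ⟦ suc j ⟧)

private
  ⟦⟧-+-suc : ∀ t j → ⟦ suc (t ℕ.+ j) ⟧ ≡ ⟦ t ⟧ + ⟦ suc j ⟧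
  ⟦⟧-+-suc t j = trans (cong ⟦_⟧ (sym (ℕP.+-suc t j))) (⟦⟧-+ t (suc j))

fact-+ : ∀ t j → fact (t ℕ.+ j) ≡ rise ⟦ t ⟧ j * fact t
fact-+ t zero = trans (cong fact (ℕP.+-identityʳ t)) (sym (ℚP.*-identityˡ _))
fact-+ t (suc j) = begin
  fact (t ℕ.+ suc j)
    ≡⟨ cong fact (ℕP.+-suc t j) ⟩
  fact (suc (t ℕ.+ j))
    ≡⟨ fact-suc (t ℕ.+ j) ⟩
  ⟦ suc (t ℕ.+ j) ⟧ * fact (t ℕ.+ j)
    ≡⟨ cong₂ _*_ (⟦⟧-+-suc t j) (fact-+ t j) ⟩
  (⟦ t ⟧ + ⟦ suc j ⟧) * (rise ⟦ t ⟧ j * fact t)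
    ≡⟨ regroup (⟦ t ⟧ + ⟦ suc j ⟧) (rise ⟦ t ⟧ j) (fact t) ⟩
  rise ⟦ t ⟧ (suc j) * fact t ∎
  where
  regroup : ∀ a b c → a * (b * c) ≡ b * a * c
  regroup = solve-∀ ℚ-ring

fact⁻¹-+ : ∀ t j → fact⁻¹ t ≡ rise ⟦ t ⟧ j * fact⁻¹ (t ℕ.+ j)
fact⁻¹-+ t zero = trans (cong fact⁻¹ (sym (ℕP.+-identityʳ t))) (sym (ℚP.*-identityˡ _))
fact⁻¹-+ t (suc j) = begin
  fact⁻¹ t
    ≡⟨ fact⁻¹-+ t j ⟩
  rise ⟦ t ⟧ j * fact⁻¹ (t ℕ.+ j)
    ≡⟨ cong (rise ⟦ t ⟧ j *_) (fact⁻¹-suc (t ℕ.+ j)) ⟩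
  rise ⟦ t ⟧ j * (⟦ suc (t ℕ.+ j) ⟧ * fact⁻¹ (suc (t ℕ.+ j)))
    ≡⟨ cong₂ (λ x y → rise ⟦ t ⟧ j * (x * fact⁻¹ y)) (⟦⟧-+-suc t j) (sym (ℕP.+-suc t j)) ⟩
  rise ⟦ t ⟧ j * ((⟦ t ⟧ + ⟦ suc j ⟧) * fact⁻¹ (t ℕ.+ suc j))
    ≡⟨ sym (ℚP.*-assoc (rise ⟦ t ⟧ j) _ _) ⟩
  rise ⟦ t ⟧ (suc j) * fact⁻¹ (t ℕ.+ suc j) ∎

factorialRatio : ℕ → ℕ → ℕ → ℕ → ℚ
factorialRatio a b c m = fact (4 ℕ.* m ℕ.+ a) * fact⁻¹ (m ℕ.+ b) * fact⁻¹ (3 ℕ.* m ℕ.+ c)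

-- [x^m] B^a for B = 1 + x B⁴; for a ≥ 1 this is a/(4m + a) · C(4m + a, m)
powB : ℕ → ℕ → ℚ
powB zero zero = 1ℚ
powB zero (suc m) = 0ℚ
powB (suc a) m = ⟦ suc a ⟧ * fact (4 ℕ.* m ℕ.+ a) * fact⁻¹ m * fact⁻¹ (3 ℕ.* m ℕ.+ suc a)

powB-zero : ∀ a → powB a 0 ≡ 1ℚ
powB-zero zero = refl
powB-zero (suc a) = begin
  ⟦ suc a ⟧ * fact a * 1ℚ * fact⁻¹ (suc a)
    ≡⟨ cong (λ x → x * fact⁻¹ (suc a)) (trans (ℚP.*-identityʳ _) (sym (fact-suc a))) ⟩
  fact (suc a) * fact⁻¹ (suc a)
    ≡⟨ inv-inverseʳ (fact≢0 (suc a)) ⟩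
  1ℚ ∎

powB-reindex : ∀ a m {p r q} → 4 ℕ.* m ℕ.+ a ≡ p → m ≡ r → 3 ℕ.* m ℕ.+ suc a ≡ q →
               powB (suc a) m ≡ ⟦ suc a ⟧ * fact p * fact⁻¹ r * fact⁻¹ q
powB-reindex a m refl refl refl = refl

powB-1-suc : ∀ m → powB 1 (suc m) ≡ powB 4 m
powB-1-suc m = begin
  powB 1 (suc m)
    ≡⟨ powB-reindex 0 (suc m) (index₁ m) refl (index₂ m) ⟩
  ⟦ 1 ⟧ * fact (suc p) * fact⁻¹ (suc m) * fact⁻¹ q
    ≡⟨ cong (λ x → ⟦ 1 ⟧ * x * fact⁻¹ (suc m) * fact⁻¹ q) (fact-suc p) ⟩
  ⟦ 1 ⟧ * (⟦ suc p ⟧ * fact p) * fact⁻¹ (suc m) * fact⁻¹ q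
    ≡⟨ cong (λ x → ⟦ 1 ⟧ * (x * fact p) * fact⁻¹ (suc m) * fact⁻¹ q) (trans (cong ⟦_⟧ (index₃ m)) (⟦⟧-* 4 (suc m))) ⟩
  ⟦ 1 ⟧ * (⟦ 4 ⟧ * ⟦ suc m ⟧ * fact p) * fact⁻¹ (suc m) * fact⁻¹ q
    ≡⟨ regroup ⟦ 4 ⟧ ⟦ suc m ⟧ (fact p) (fact⁻¹ (suc m)) (fact⁻¹ q) ⟩
  ⟦ 4 ⟧ * fact p * (⟦ suc m ⟧ * fact⁻¹ (suc m)) * fact⁻¹ q
    ≡⟨ cong (λ x → ⟦ 4 ⟧ * fact p * x * fact⁻¹ q) (sym (fact⁻¹-suc m)) ⟩
  powB 4 m ∎
  where
  p = 4 ℕ.* m ℕ.+ 3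
  q = 3 ℕ.* m ℕ.+ 4
  index₁ : ∀ m → 4 ℕ.* suc m ℕ.+ 0 ≡ suc (4 ℕ.* m ℕ.+ 3)
  index₁ = ℕ-Solver.solve-∀
  index₂ : ∀ m → 3 ℕ.* suc m ℕ.+ 1 ≡ 3 ℕ.* m ℕ.+ 4
  index₂ = ℕ-Solver.solve-∀
  index₃ : ∀ m → suc (4 ℕ.* m ℕ.+ 3) ≡ 4 ℕ.* suc m
  index₃ = ℕ-Solver.solve-∀
  regroup : ∀ a b c d e → ⟦ 1 ⟧ * (a * b * c) * d * e ≡ a * c * (b * d) * e
  regroup = solve-∀ ℚ-ring

powB-2+a-suc : ∀ a m → powB (2 ℕ.+ a) (suc m) ≡ ⟦ 2 ℕ.+ a ⟧ * ⟦ suc (4 ℕ.* m ℕ.+ (a ℕ.+ 4)) ⟧ * factorialRatio (a ℕ.+ 4) 1 (suc (a ℕ.+ 4)) m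
powB-2+a-suc a m = begin
  powB (2 ℕ.+ a) (suc m)
    ≡⟨ powB-reindex (suc a) (suc m) (index₁ m a) (ℕP.+-comm 1 m) (index₂ m a) ⟩
  ⟦ 2 ℕ.+ a ⟧ * fact (suc p) * fact⁻¹ (m ℕ.+ 1) * fact⁻¹ q
    ≡⟨ cong (λ x → ⟦ 2 ℕ.+ a ⟧ * x * fact⁻¹ (m ℕ.+ 1) * fact⁻¹ q) (fact-suc p) ⟩
  ⟦ 2 ℕ.+ a ⟧ * (⟦ suc p ⟧ * fact p) * fact⁻¹ (m ℕ.+ 1) * fact⁻¹ q
    ≡⟨ regroup ⟦ 2 ℕ.+ a ⟧ ⟦ suc p ⟧ (fact p) (fact⁻¹ (m ℕ.+ 1)) (fact⁻¹ q) ⟩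
  ⟦ 2 ℕ.+ a ⟧ * ⟦ suc p ⟧ * factorialRatio (a ℕ.+ 4) 1 (suc (a ℕ.+ 4)) m ∎
  where
  p = 4 ℕ.* m ℕ.+ (a ℕ.+ 4)
  q = 3 ℕ.* m ℕ.+ suc (a ℕ.+ 4)
  index₁ : ∀ m a → 4 ℕ.* suc m ℕ.+ suc a ≡ suc (4 ℕ.* m ℕ.+ (a ℕ.+ 4))
  index₁ = ℕ-Solver.solve-∀
  index₂ : ∀ m a → 3 ℕ.* suc m ℕ.+ suc (suc a) ≡ 3 ℕ.* m ℕ.+ suc (a ℕ.+ 4)
  index₂ = ℕ-Solver.solve-∀
  regroup : ∀ c s f i j → c * (s * f) * i * j ≡ c * s * (f * i * j)
  regroup = solve-∀ ℚ-ring

powB-1+a-suc : ∀ a m → powB (suc a) (suc m) ≡ ⟦ suc a ⟧ * ⟦ suc (3 ℕ.* m ℕ.+ (a ℕ.+ 4)) ⟧ * factorialRatio (a ℕ.+ 4) 1 (suc (a ℕ.+ 4)) m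
powB-1+a-suc a m = begin
  powB (suc a) (suc m)
    ≡⟨ powB-reindex a (suc m) (index₁ m a) (ℕP.+-comm 1 m) (index₂ m a) ⟩
  ⟦ suc a ⟧ * fact p * fact⁻¹ (m ℕ.+ 1) * fact⁻¹ q
    ≡⟨ cong (λ x → ⟦ suc a ⟧ * fact p * fact⁻¹ (m ℕ.+ 1) * x)
            (trans (fact⁻¹-suc q) (cong (λ t → ⟦ suc q ⟧ * fact⁻¹ t) (sym (ℕP.+-suc (3 ℕ.* m) (a ℕ.+ 4))))) ⟩
  ⟦ suc a ⟧ * fact p * fact⁻¹ (m ℕ.+ 1) * (⟦ suc q ⟧ * fact⁻¹ (3 ℕ.* m ℕ.+ suc (a ℕ.+ 4)))
    ≡⟨ regroup ⟦ suc a ⟧ (fact p) (fact⁻¹ (m ℕ.+ 1)) ⟦ suc q ⟧ (fact⁻¹ (3 ℕ.* m ℕ.+ suc (a ℕ.+ 4))) ⟩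
  ⟦ suc a ⟧ * ⟦ suc q ⟧ * factorialRatio (a ℕ.+ 4) 1 (suc (a ℕ.+ 4)) m ∎
  where
  p = 4 ℕ.* m ℕ.+ (a ℕ.+ 4)
  q = 3 ℕ.* m ℕ.+ (a ℕ.+ 4)
  index₁ : ∀ m a → 4 ℕ.* suc m ℕ.+ a ≡ 4 ℕ.* m ℕ.+ (a ℕ.+ 4)
  index₁ = ℕ-Solver.solve-∀
  index₂ : ∀ m a → 3 ℕ.* suc m ℕ.+ suc a ≡ 3 ℕ.* m ℕ.+ (a ℕ.+ 4)
  index₂ = ℕ-Solver.solve-∀
  regroup : ∀ c f i s j → c * f * i * (s * j) ≡ c * s * (f * i * j)
  regroup = solve-∀ ℚ-ring

powB-5+a : ∀ a m → powB (suc (a ℕ.+ 4)) m ≡ ⟦ suc (a ℕ.+ 4) ⟧ * ⟦ suc m ⟧ * factorialRatio (a ℕ.+ 4) 1 (suc (a ℕ.+ 4)) m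
powB-5+a a m = begin
  powB (suc (a ℕ.+ 4)) m
    ≡⟨ cong (λ x → ⟦ suc (a ℕ.+ 4) ⟧ * fact p * x * fact⁻¹ q)
            (trans (fact⁻¹-suc m) (cong (λ t → ⟦ suc m ⟧ * fact⁻¹ t) (ℕP.+-comm 1 m))) ⟩
  ⟦ suc (a ℕ.+ 4) ⟧ * fact p * (⟦ suc m ⟧ * fact⁻¹ (m ℕ.+ 1)) * fact⁻¹ q
    ≡⟨ regroup ⟦ suc (a ℕ.+ 4) ⟧ (fact p) ⟦ suc m ⟧ (fact⁻¹ (m ℕ.+ 1)) (fact⁻¹ q) ⟩
  ⟦ suc (a ℕ.+ 4) ⟧ * ⟦ suc m ⟧ * factorialRatio (a ℕ.+ 4) 1 (suc (a ℕ.+ 4)) m ∎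
  where
  p = 4 ℕ.* m ℕ.+ (a ℕ.+ 4)
  q = 3 ℕ.* m ℕ.+ suc (a ℕ.+ 4)
  regroup : ∀ c f s i j → c * f * (s * i) * j ≡ c * s * (f * i * j)
  regroup = solve-∀ ℚ-ring

powB-rec : ∀ a m → powB (suc a) (suc m) ≡ powB a (suc m) + powB (a ℕ.+ 4) m
powB-rec zero m = trans (powB-1-suc m) (sym (ℚP.+-identityˡ (powB 4 m)))
powB-rec (suc a) m = begin
  powB (2 ℕ.+ a) (suc m)
    ≡⟨ powB-2+a-suc a m ⟩
  ⟦ 2 ℕ.+ a ⟧ * ⟦ suc p ⟧ * T
    ≡⟨ cong (_* T) coefficients ⟩
  (⟦ suc a ⟧ * ⟦ suc q ⟧ + ⟦ suc (a ℕ.+ 4) ⟧ * ⟦ suc m ⟧) * T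
    ≡⟨ ℚP.*-distribʳ-+ T (⟦ suc a ⟧ * ⟦ suc q ⟧) (⟦ suc (a ℕ.+ 4) ⟧ * ⟦ suc m ⟧) ⟩
  ⟦ suc a ⟧ * ⟦ suc q ⟧ * T + ⟦ suc (a ℕ.+ 4) ⟧ * ⟦ suc m ⟧ * T
    ≡⟨ sym (cong₂ _+_ (powB-1+a-suc a m) (powB-5+a a m)) ⟩
  powB (suc a) (suc m) + powB (suc a ℕ.+ 4) m ∎
  where
  p = 4 ℕ.* m ℕ.+ (a ℕ.+ 4)
  q = 3 ℕ.* m ℕ.+ (a ℕ.+ 4)
  T = factorialRatio (a ℕ.+ 4) 1 (suc (a ℕ.+ 4)) m
  ℕ-identity : ∀ m a → (2 ℕ.+ a) ℕ.* suc (4 ℕ.* m ℕ.+ (a ℕ.+ 4))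
               ≡ suc a ℕ.* suc (3 ℕ.* m ℕ.+ (a ℕ.+ 4)) ℕ.+ suc (a ℕ.+ 4) ℕ.* suc m
  ℕ-identity = ℕ-Solver.solve-∀
  coefficients : ⟦ 2 ℕ.+ a ⟧ * ⟦ suc p ⟧ ≡ ⟦ suc a ⟧ * ⟦ suc q ⟧ + ⟦ suc (a ℕ.+ 4) ⟧ * ⟦ suc m ⟧
  coefficients = begin
    ⟦ 2 ℕ.+ a ⟧ * ⟦ suc p ⟧
      ≡⟨ sym (⟦⟧-* (2 ℕ.+ a) (suc p)) ⟩
    ⟦ (2 ℕ.+ a) ℕ.* suc p ⟧
      ≡⟨ cong ⟦_⟧ (ℕ-identity m a) ⟩
    ⟦ suc a ℕ.* suc q ℕ.+ suc (a ℕ.+ 4) ℕ.* suc m ⟧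
      ≡⟨ ⟦⟧-+ (suc a ℕ.* suc q) (suc (a ℕ.+ 4) ℕ.* suc m) ⟩
    ⟦ suc a ℕ.* suc q ⟧ + ⟦ suc (a ℕ.+ 4) ℕ.* suc m ⟧
      ≡⟨ cong₂ _+_ (⟦⟧-* (suc a) (suc q)) (⟦⟧-* (suc (a ℕ.+ 4)) (suc m)) ⟩
    ⟦ suc a ⟧ * ⟦ suc q ⟧ + ⟦ suc (a ℕ.+ 4) ⟧ * ⟦ suc m ⟧ ∎

powB-suc : ∀ a k → powB (suc a) k ≡ powB a k + shift 1 (powB (a ℕ.+ 4)) k
powB-suc a zero = trans (powB-zero (suc a)) (sym (trans (ℚP.+-identityʳ _) (powB-zero a)))
powB-suc a (suc m) = powB-rec a m

⋆-identityˡ : ∀ (h : ℕ → ℚ) n → (powB 0 ⋆ h) n ≡ h n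
⋆-identityˡ h zero = ℚP.*-identityˡ (h 0)
⋆-identityˡ h (suc n) = begin
  (powB 0 ⋆ h) (suc n)
    ≡⟨ sumTo-suc n _ ⟩
  1ℚ * h (suc n) + sumTo n (λ k → 0ℚ * h (n ∸ k))
    ≡⟨ cong₂ _+_ (ℚP.*-identityˡ (h (suc n))) (sumTo-zero n _ (λ k → ℚP.*-zeroˡ (h (n ∸ k)))) ⟩
  h (suc n) + 0ℚ
    ≡⟨ ℚP.+-identityʳ (h (suc n)) ⟩
  h (suc n) ∎

powB-⋆ : ∀ a b n → (powB a ⋆ powB b) n ≡ powB (a ℕ.+ b) n
powB-⋆ a b zero = trans (cong₂ _*_ (powB-zero a) (powB-zero b)) (sym (powB-zero (a ℕ.+ b)))
powB-⋆ zero b (suc n) = ⋆-identityˡ (powB b) (suc n)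
powB-⋆ (suc a) b (suc n) = begin
  (powB (suc a) ⋆ powB b) (suc n)
    ≡⟨ ⋆-cong {h = powB b} (powB-suc a) (λ _ → refl) (suc n) ⟩
  ((λ k → powB a k + shift 1 (powB (a ℕ.+ 4)) k) ⋆ powB b) (suc n)
    ≡⟨ ⋆-distribʳ-+ (powB a) (shift 1 (powB (a ℕ.+ 4))) (powB b) (suc n) ⟩
  (powB a ⋆ powB b) (suc n) + (shift 1 (powB (a ℕ.+ 4)) ⋆ powB b) (suc n)
    ≡⟨ cong₂ _+_ (powB-⋆ a b (suc n)) (trans (shift-⋆ (powB (a ℕ.+ 4)) (powB b) n) (powB-⋆ (a ℕ.+ 4) b n)) ⟩
  powB (a ℕ.+ b) (suc n) + powB (a ℕ.+ 4 ℕ.+ b) n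
    ≡⟨ cong (λ i → powB (a ℕ.+ b) (suc n) + powB i n) (index a b) ⟩
  powB (a ℕ.+ b) (suc n) + powB (a ℕ.+ b ℕ.+ 4) n
    ≡⟨ sym (powB-rec (a ℕ.+ b) n) ⟩
  powB (suc a ℕ.+ b) (suc n) ∎
  where
  index : ∀ a b → a ℕ.+ 4 ℕ.+ b ≡ a ℕ.+ b ℕ.+ 4
  index = ℕ-Solver.solve-∀

-- Polynomials in B

infixl 6 _⊕_
infixl 7 _⊛_

_⊕_ : List ℤ → List ℤ → List ℤ
[] ⊕ ws = ws
(v ∷ vs) ⊕ [] = v ∷ vs
(v ∷ vs) ⊕ (w ∷ ws) = v ℤ.+ w ∷ vs ⊕ ws

_⊛_ : List ℤ → List ℤ → List ℤ
[] ⊛ ws = []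
(v ∷ vs) ⊛ ws = List.map (v ℤ.*_) ws ⊕ (+ 0 ∷ vs ⊛ ws)

_^ᴸ_ : List ℤ → ℕ → List ℤ
W ^ᴸ zero = + 1 ∷ []
W ^ᴸ suc r = W ⊛ W ^ᴸ r

W₁ : List ℤ
W₁ = + 1 ∷ + 1 ∷ ℤ.-1ℤ ∷ []

length-⊕ : ∀ vs ws → length (vs ⊕ ws) ≡ length vs ℕ.⊔ length ws
length-⊕ [] ws = refl
length-⊕ (v ∷ vs) [] = refl
length-⊕ (v ∷ vs) (w ∷ ws) = cong suc (length-⊕ vs ws)

length-W₁⊛ : ∀ V → 1 ℕ.≤ length V → length (W₁ ⊛ V) ≡ 2 ℕ.+ length V
length-W₁⊛ V 1≤L = begin
  length (W₁ ⊛ V)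
    ≡⟨ length-scaled-⊕ (+ 1) V (+ 0 ∷ (+ 1 ∷ ℤ.-1ℤ ∷ []) ⊛ V) ⟩
  L ℕ.⊔ suc (length ((+ 1 ∷ ℤ.-1ℤ ∷ []) ⊛ V))
    ≡⟨ cong (λ l → L ℕ.⊔ suc l) (length-scaled-⊕ (+ 1) V (+ 0 ∷ (ℤ.-1ℤ ∷ []) ⊛ V)) ⟩
  L ℕ.⊔ suc (L ℕ.⊔ suc (length ((ℤ.-1ℤ ∷ []) ⊛ V)))
    ≡⟨ cong (λ l → L ℕ.⊔ suc (L ℕ.⊔ suc l)) (length-scaled-⊕ ℤ.-1ℤ V (+ 0 ∷ [])) ⟩
  L ℕ.⊔ suc (L ℕ.⊔ suc (L ℕ.⊔ 1))
    ≡⟨ cong (λ l → L ℕ.⊔ suc (L ℕ.⊔ suc l)) (ℕP.m≥n⇒m⊔n≡m 1≤L) ⟩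
  L ℕ.⊔ suc (L ℕ.⊔ suc L)
    ≡⟨ cong (λ l → L ℕ.⊔ suc l) (ℕP.m≤n⇒m⊔n≡n (ℕP.n≤1+n L)) ⟩
  L ℕ.⊔ suc (suc L)
    ≡⟨ ℕP.m≤n⇒m⊔n≡n (ℕP.m≤n+m L 2) ⟩
  2 ℕ.+ L ∎
  where
  L = length V
  length-scaled-⊕ : ∀ c V W → length (List.map (c ℤ.*_) V ⊕ W) ≡ length V ℕ.⊔ length W
  length-scaled-⊕ c V W = trans (length-⊕ (List.map (c ℤ.*_) V) W) (cong (ℕ._⊔ length W) (length-map (c ℤ.*_) V))

length-W₁^ᴸ : ∀ r → length (W₁ ^ᴸ r) ≡ suc (2 ℕ.* r)
length-W₁^ᴸ zero = refl
length-W₁^ᴸ (suc r) = begin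
  length (W₁ ⊛ W₁ ^ᴸ r)   ≡⟨ length-W₁⊛ (W₁ ^ᴸ r) (subst (1 ℕ.≤_) (sym (length-W₁^ᴸ r)) (s≤s z≤n)) ⟩
  2 ℕ.+ length (W₁ ^ᴸ r)  ≡⟨ cong (2 ℕ.+_) (length-W₁^ᴸ r) ⟩
  suc (suc (suc (2 ℕ.* r))) ≡⟨ cong suc (sym (ℕP.*-suc 2 r)) ⟩
  suc (2 ℕ.* suc r)       ∎

-- [x^m] B^a · W(B), for the polynomial W given by its coefficients, lowest degree first
polyB : ℕ → List ℤ → ℕ → ℚ
polyB a [] m = 0ℚ
polyB a (w ∷ ws) m = ι w * powB a m + polyB (suc a) ws m

polyB-⊕ : ∀ a V W m → polyB a (V ⊕ W) m ≡ polyB a V m + polyB a W m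
polyB-⊕ a [] W m = sym (ℚP.+-identityˡ _)
polyB-⊕ a (v ∷ vs) [] m = sym (ℚP.+-identityʳ _)
polyB-⊕ a (v ∷ vs) (w ∷ ws) m = begin
  ι (v ℤ.+ w) * powB a m + polyB (suc a) (vs ⊕ ws) m
    ≡⟨ cong₂ (λ x y → x * powB a m + y) (ι-+ v w) (polyB-⊕ (suc a) vs ws m) ⟩
  (ι v + ι w) * powB a m + (polyB (suc a) vs m + polyB (suc a) ws m)
    ≡⟨ regroup (ι v) (ι w) (powB a m) (polyB (suc a) vs m) (polyB (suc a) ws m) ⟩
  (ι v * powB a m + polyB (suc a) vs m) + (ι w * powB a m + polyB (suc a) ws m) ∎
  where
  regroup : ∀ v w x y z → (v + w) * x + (y + z) ≡ (v * x + y) + (w * x + z)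
  regroup = solve-∀ ℚ-ring

polyB-scale : ∀ a c W m → polyB a (List.map (c ℤ.*_) W) m ≡ ι c * polyB a W m
polyB-scale a c [] m = sym (ℚP.*-zeroʳ (ι c))
polyB-scale a c (w ∷ ws) m = begin
  ι (c ℤ.* w) * powB a m + polyB (suc a) (List.map (c ℤ.*_) ws) m
    ≡⟨ cong₂ (λ x y → x * powB a m + y) (ι-* c w) (polyB-scale (suc a) c ws m) ⟩
  ι c * ι w * powB a m + ι c * polyB (suc a) ws m
    ≡⟨ regroup (ι c) (ι w) (powB a m) (polyB (suc a) ws m) ⟩
  ι c * (ι w * powB a m + polyB (suc a) ws m) ∎
  where
  regroup : ∀ c w x y → c * w * x + c * y ≡ c * (w * x + y)
  regroup = solve-∀ ℚ-ring

polyB-zero∷ : ∀ a W m → polyB a (+ 0 ∷ W) m ≡ polyB (suc a) W m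
polyB-zero∷ a W m = trans (cong (_+ polyB (suc a) W m) (ℚP.*-zeroˡ (powB a m))) (ℚP.+-identityˡ _)

powB-⋆-polyB : ∀ a b W n → (powB a ⋆ polyB b W) n ≡ polyB (a ℕ.+ b) W n
powB-⋆-polyB a b [] n = ⋆-zeroʳ (powB a) n
powB-⋆-polyB a b (w ∷ ws) n = begin
  (powB a ⋆ (λ k → ι w * powB b k + polyB (suc b) ws k)) n
    ≡⟨ ⋆-distribˡ-+ (λ k → ι w * powB b k) (polyB (suc b) ws) (powB a) n ⟩
  (powB a ⋆ (λ k → ι w * powB b k)) n + (powB a ⋆ polyB (suc b) ws) n
    ≡⟨ cong₂ _+_ (trans (⋆-scaleʳ (ι w) (powB b) (powB a) n) (cong (ι w *_) (powB-⋆ a b n)))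
                 (powB-⋆-polyB a (suc b) ws n) ⟩
  ι w * powB (a ℕ.+ b) n + polyB (a ℕ.+ suc b) ws n
    ≡⟨ cong (λ i → ι w * powB (a ℕ.+ b) n + polyB i ws n) (ℕP.+-suc a b) ⟩
  polyB (a ℕ.+ b) (w ∷ ws) n ∎

polyB-⋆ : ∀ a b V W n → (polyB a V ⋆ polyB b W) n ≡ polyB (a ℕ.+ b) (V ⊛ W) n
polyB-⋆ a b [] W n = ⋆-zeroˡ (polyB b W) n
polyB-⋆ a b (v ∷ vs) W n = begin
  ((λ k → ι v * powB a k + polyB (suc a) vs k) ⋆ polyB b W) n
    ≡⟨ ⋆-distribʳ-+ (λ k → ι v * powB a k) (polyB (suc a) vs) (polyB b W) n ⟩
  ((λ k → ι v * powB a k) ⋆ polyB b W) n + (polyB (suc a) vs ⋆ polyB b W) n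
    ≡⟨ cong₂ _+_ (trans (⋆-scaleˡ (ι v) (powB a) (polyB b W) n) (cong (ι v *_) (powB-⋆-polyB a b W n)))
                 (polyB-⋆ (suc a) b vs W n) ⟩
  ι v * polyB (a ℕ.+ b) W n + polyB (suc (a ℕ.+ b)) (vs ⊛ W) n
    ≡⟨ sym (cong₂ _+_ (polyB-scale (a ℕ.+ b) v W n) (polyB-zero∷ (a ℕ.+ b) (vs ⊛ W) n)) ⟩
  polyB (a ℕ.+ b) (List.map (v ℤ.*_) W) n + polyB (a ℕ.+ b) (+ 0 ∷ vs ⊛ W) n
    ≡⟨ sym (polyB-⊕ (a ℕ.+ b) (List.map (v ℤ.*_) W) (+ 0 ∷ vs ⊛ W) n) ⟩
  polyB (a ℕ.+ b) ((v ∷ vs) ⊛ W) n ∎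

-- Hypergeometric normal form

open ℚ[ℤ] using (Polynomial; con; var; _:+_; _:*_; _:-_; prove)

infix 8 _at_

_at_ : Polynomial 1 → ℚ → ℚ
p at x = ℚ[ℤ].⟦ p ⟧ (x ∷ [])

X : Polynomial 1
X = var Fin.zero

‵_ : ℕ → Polynomial 1
‵ n = con (+ n)

affine : ℕ → ℕ → Polynomial 1
affine c d = ‵ c :* X :+ ‵ d

affine-at : ∀ c m d → affine c d at ⟦ m ⟧ ≡ ⟦ c ℕ.* m ℕ.+ d ⟧
affine-at c m d = sym (trans (⟦⟧-+ (c ℕ.* m) d) (cong (_+ ⟦ d ⟧) (⟦⟧-* c m)))

riseₚ : Polynomial 1 → ℕ → Polynomial 1
riseₚ p zero = ‵ 1
riseₚ p (suc j) = riseₚ p j :* (p :+ ‵ suc j)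

riseₚ-at : ∀ p j x → riseₚ p j at x ≡ rise (p at x) j
riseₚ-at p zero x = refl
riseₚ-at p (suc j) x = cong (_* (p at x + ⟦ suc j ⟧)) (riseₚ-at p j x)

riseₚ-affine-at : ∀ c d j m → riseₚ (affine c d) j at ⟦ m ⟧ ≡ rise ⟦ c ℕ.* m ℕ.+ d ⟧ j
riseₚ-affine-at c d j m = trans (riseₚ-at (affine c d) j ⟦ m ⟧) (cong (λ x → rise x j) (affine-at c m d))

powBₚ : ℕ → ℕ → ℕ → ℕ → Polynomial 1
powBₚ a i b k = ‵ suc (a ℕ.+ i) :* riseₚ (affine 4 a) i :* riseₚ X b :* riseₚ (affine 3 (suc (a ℕ.+ i))) k

powB-factorialRatio : ∀ a i b k m →
  powB (suc (a ℕ.+ i)) m ≡ powBₚ a i b k at ⟦ m ⟧ * factorialRatio a b (suc (a ℕ.+ i) ℕ.+ k) m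
powB-factorialRatio a i b k m = begin
  ⟦ s ⟧ * fact (4 ℕ.* m ℕ.+ (a ℕ.+ i)) * fact⁻¹ m * fact⁻¹ (3 ℕ.* m ℕ.+ s)
    ≡⟨ cong₂ (λ x y → ⟦ s ⟧ * x * fact⁻¹ m * y) numerator denominator ⟩
  ⟦ s ⟧ * (R₁ * F) * fact⁻¹ m * (R₃ * I₃)
    ≡⟨ cong (λ x → ⟦ s ⟧ * (R₁ * F) * x * (R₃ * I₃)) (fact⁻¹-+ m b) ⟩
  ⟦ s ⟧ * (R₁ * F) * (R₂ * I₂) * (R₃ * I₃)
    ≡⟨ regroup ⟦ s ⟧ R₁ F R₂ I₂ R₃ I₃ ⟩
  ⟦ s ⟧ * R₁ * R₂ * R₃ * (F * I₂ * I₃)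
    ≡⟨ sym (cong₃ (λ x y z → ⟦ s ⟧ * x * y * z * (F * I₂ * I₃))
                  (riseₚ-affine-at 4 a i m) (riseₚ-at X b ⟦ m ⟧) (riseₚ-affine-at 3 s k m)) ⟩
  powBₚ a i b k at ⟦ m ⟧ * factorialRatio a b (s ℕ.+ k) m ∎
  where
  s = suc (a ℕ.+ i)
  R₁ = rise ⟦ 4 ℕ.* m ℕ.+ a ⟧ i
  R₂ = rise ⟦ m ⟧ b
  R₃ = rise ⟦ 3 ℕ.* m ℕ.+ s ⟧ k
  F = fact (4 ℕ.* m ℕ.+ a)
  I₂ = fact⁻¹ (m ℕ.+ b)
  I₃ = fact⁻¹ (3 ℕ.* m ℕ.+ (s ℕ.+ k))
  numerator : fact (4 ℕ.* m ℕ.+ (a ℕ.+ i)) ≡ R₁ * F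
  numerator = trans (cong fact (sym (ℕP.+-assoc (4 ℕ.* m) a i))) (fact-+ (4 ℕ.* m ℕ.+ a) i)
  denominator : fact⁻¹ (3 ℕ.* m ℕ.+ s) ≡ R₃ * I₃
  denominator = trans (fact⁻¹-+ (3 ℕ.* m ℕ.+ s) k) (cong (λ t → R₃ * fact⁻¹ t) (ℕP.+-assoc (3 ℕ.* m) s k))
  regroup : ∀ s r₁ f r₂ i₂ r₃ i₃ → s * (r₁ * f) * (r₂ * i₂) * (r₃ * i₃) ≡ s * r₁ * r₂ * r₃ * (f * i₂ * i₃)
  regroup = solve-∀ ℚ-ring

polyBₚ : ℕ → ℕ → ℕ → List ℤ → Polynomial 1
polyBₚ a i b [] = ‵ 0
polyBₚ a i b (w ∷ ws) = con w :* powBₚ a i b (length ws) :+ polyBₚ a (suc i) b ws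

polyB-factorialRatio : ∀ a i b W m →
  polyB (suc (a ℕ.+ i)) W m ≡ polyBₚ a i b W at ⟦ m ⟧ * factorialRatio a b (a ℕ.+ i ℕ.+ length W) m
polyB-factorialRatio a i b [] m = sym (ℚP.*-zeroˡ (factorialRatio a b (a ℕ.+ i ℕ.+ 0) m))
polyB-factorialRatio a i b (w ∷ ws) m = begin
  ι w * powB (suc (a ℕ.+ i)) m + polyB (suc (suc (a ℕ.+ i))) ws m
    ≡⟨ cong₂ (λ x y → ι w * x + y) (powB-factorialRatio a i b (length ws) m)
         (trans (cong (λ j → polyB (suc j) ws m) (sym (ℕP.+-suc a i))) (polyB-factorialRatio a (suc i) b ws m)) ⟩
  ι w * (T * ratio (suc (a ℕ.+ i) ℕ.+ length ws)) + P * ratio (a ℕ.+ suc i ℕ.+ length ws)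
    ≡⟨ cong₂ (λ j k → ι w * (T * ratio j) + P * ratio k) (index₁ a i (length ws)) (index₂ a i (length ws)) ⟩
  ι w * (T * ratio (a ℕ.+ i ℕ.+ suc (length ws))) + P * ratio (a ℕ.+ i ℕ.+ suc (length ws))
    ≡⟨ factor (ι w) T P (ratio (a ℕ.+ i ℕ.+ suc (length ws))) ⟩
  (ι w * T + P) * ratio (a ℕ.+ i ℕ.+ suc (length ws)) ∎
  where
  T = powBₚ a i b (length ws) at ⟦ m ⟧
  P = polyBₚ a (suc i) b ws at ⟦ m ⟧
  ratio : ℕ → ℚ
  ratio c = factorialRatio a b c m
  index₁ : ∀ a i l → suc (a ℕ.+ i) ℕ.+ l ≡ a ℕ.+ i ℕ.+ suc l
  index₁ = ℕ-Solver.solve-∀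
  index₂ : ∀ a i l → a ℕ.+ suc i ℕ.+ l ≡ a ℕ.+ i ℕ.+ suc l
  index₂ = ℕ-Solver.solve-∀
  factor : ∀ w t p h → w * (t * h) + p * h ≡ (w * t + p) * h
  factor = solve-∀ ℚ-ring

-- Powers of g

gCoeff-unfold : ∀ n → gCoeff (suc n) ≡ ⟦ 2 ⟧ * fact (4 ℕ.* suc n ℕ.+ 1) * fact⁻¹ (suc n ℕ.+ 1) * fact⁻¹ (3 ℕ.* suc n ℕ.+ 2)
gCoeff-unfold n = begin
  ⟦ 2 ℕ.* p ! ⟧ ÷' ⟦ q ! ℕ.* s ! ⟧
    ≡⟨ ÷'-≡-*inv ⟦ 2 ℕ.* p ! ⟧ ⟦ q ! ℕ.* s ! ⟧ ⟩
  ⟦ 2 ℕ.* p ! ⟧ * inv ⟦ q ! ℕ.* s ! ⟧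
    ≡⟨ cong₂ _*_ (⟦⟧-* 2 (p !)) (trans (cong inv (⟦⟧-* (q !) (s !))) (inv-* (fact q) (fact s))) ⟩
  ⟦ 2 ⟧ * fact p * (fact⁻¹ q * fact⁻¹ s)
    ≡⟨ sym (ℚP.*-assoc (⟦ 2 ⟧ * fact p) (fact⁻¹ q) (fact⁻¹ s)) ⟩
  ⟦ 2 ⟧ * fact p * fact⁻¹ q * fact⁻¹ s ∎
  where
  p = 4 ℕ.* suc n ℕ.+ 1
  q = suc n ℕ.+ 1
  s = 3 ℕ.* suc n ℕ.+ 2

gCoeff≢0 : ∀ n → gCoeff (suc n) ≢ 0ℚ
gCoeff≢0 n g≡0 = *-≢0 (*-≢0 (*-≢0 (⟦suc⟧≢0 1) (fact≢0 p)) (fact⁻¹≢0 q)) (fact⁻¹≢0 s)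
  (trans (sym (gCoeff-unfold n)) g≡0)
  where
  p = 4 ℕ.* suc n ℕ.+ 1
  q = suc n ℕ.+ 1
  s = 3 ℕ.* suc n ℕ.+ 2

gₚ : ℕ → Polynomial 1
gₚ r = ‵ 2 :* riseₚ (affine 4 (4 ℕ.* r ℕ.+ 3)) 2 :* riseₚ (affine 3 (3 ℕ.* r ℕ.+ 5)) (3 ℕ.* r ℕ.+ 1)

gCoeff-factorialRatio : ∀ r m →
  gCoeff (suc r ℕ.+ m) ≡ gₚ r at ⟦ m ⟧ * factorialRatio (4 ℕ.* r ℕ.+ 3) (r ℕ.+ 2) (6 ℕ.* r ℕ.+ 6) m
gCoeff-factorialRatio r m = begin
  gCoeff (suc (r ℕ.+ m))
    ≡⟨ gCoeff-unfold (r ℕ.+ m) ⟩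
  ⟦ 2 ⟧ * fact (4 ℕ.* suc (r ℕ.+ m) ℕ.+ 1) * fact⁻¹ (suc (r ℕ.+ m) ℕ.+ 1) * fact⁻¹ (3 ℕ.* suc (r ℕ.+ m) ℕ.+ 2)
    ≡⟨ cong₃ (λ x y z → ⟦ 2 ⟧ * x * fact⁻¹ y * z) numerator (index₂ r m) denominator ⟩
  ⟦ 2 ⟧ * (R₁ * F) * I₂ * (R₃ * I₃)
    ≡⟨ regroup ⟦ 2 ⟧ R₁ F I₂ R₃ I₃ ⟩
  ⟦ 2 ⟧ * R₁ * R₃ * (F * I₂ * I₃)
    ≡⟨ sym (cong₂ (λ x y → ⟦ 2 ⟧ * x * y * (F * I₂ * I₃))
                  (riseₚ-affine-at 4 (4 ℕ.* r ℕ.+ 3) 2 m) (riseₚ-affine-at 3 (3 ℕ.* r ℕ.+ 5) (3 ℕ.* r ℕ.+ 1) m)) ⟩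
  gₚ r at ⟦ m ⟧ * factorialRatio (4 ℕ.* r ℕ.+ 3) (r ℕ.+ 2) (6 ℕ.* r ℕ.+ 6) m ∎
  where
  R₁ = rise ⟦ 4 ℕ.* m ℕ.+ (4 ℕ.* r ℕ.+ 3) ⟧ 2
  R₃ = rise ⟦ 3 ℕ.* m ℕ.+ (3 ℕ.* r ℕ.+ 5) ⟧ (3 ℕ.* r ℕ.+ 1)
  F = fact (4 ℕ.* m ℕ.+ (4 ℕ.* r ℕ.+ 3))
  I₂ = fact⁻¹ (m ℕ.+ (r ℕ.+ 2))
  I₃ = fact⁻¹ (3 ℕ.* m ℕ.+ (6 ℕ.* r ℕ.+ 6))
  index₁ : ∀ r m → 4 ℕ.* suc (r ℕ.+ m) ℕ.+ 1 ≡ 4 ℕ.* m ℕ.+ (4 ℕ.* r ℕ.+ 3) ℕ.+ 2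
  index₁ = ℕ-Solver.solve-∀
  index₂ : ∀ r m → suc (r ℕ.+ m) ℕ.+ 1 ≡ m ℕ.+ (r ℕ.+ 2)
  index₂ = ℕ-Solver.solve-∀
  index₃ : ∀ r m → 3 ℕ.* suc (r ℕ.+ m) ℕ.+ 2 ≡ 3 ℕ.* m ℕ.+ (3 ℕ.* r ℕ.+ 5)
  index₃ = ℕ-Solver.solve-∀
  index₄ : ∀ r m → 3 ℕ.* m ℕ.+ (3 ℕ.* r ℕ.+ 5) ℕ.+ (3 ℕ.* r ℕ.+ 1) ≡ 3 ℕ.* m ℕ.+ (6 ℕ.* r ℕ.+ 6)
  index₄ = ℕ-Solver.solve-∀
  numerator : fact (4 ℕ.* suc (r ℕ.+ m) ℕ.+ 1) ≡ R₁ * F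
  numerator = trans (cong fact (index₁ r m)) (fact-+ (4 ℕ.* m ℕ.+ (4 ℕ.* r ℕ.+ 3)) 2)
  denominator : fact⁻¹ (3 ℕ.* suc (r ℕ.+ m) ℕ.+ 2) ≡ R₃ * I₃
  denominator = trans (cong fact⁻¹ (index₃ r m))
    (trans (fact⁻¹-+ (3 ℕ.* m ℕ.+ (3 ℕ.* r ℕ.+ 5)) (3 ℕ.* r ℕ.+ 1)) (cong (λ t → R₃ * fact⁻¹ t) (index₄ r m)))
  regroup : ∀ c r₁ f i₂ r₃ i₃ → c * (r₁ * f) * i₂ * (r₃ * i₃) ≡ c * r₁ * r₃ * (f * i₂ * i₃)
  regroup = solve-∀ ℚ-ring

gₚ≢0 : ∀ r m → gₚ r at ⟦ m ⟧ ≢ 0ℚ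
gₚ≢0 r m g≡0 = gCoeff≢0 (r ℕ.+ m) (begin
  gCoeff (suc r ℕ.+ m)            ≡⟨ gCoeff-factorialRatio r m ⟩
  gₚ r at ⟦ m ⟧ * ratio           ≡⟨ cong (_* ratio) g≡0 ⟩
  0ℚ * ratio                      ≡⟨ ℚP.*-zeroˡ ratio ⟩
  0ℚ                              ∎)
  where
  ratio = factorialRatio (4 ℕ.* r ℕ.+ 3) (r ℕ.+ 2) (6 ℕ.* r ℕ.+ 6) m

g-identity : ∀ x → gₚ 0 at x ≡ polyBₚ 3 0 2 W₁ at x
g-identity x = prove (x ∷ []) (gₚ 0) (polyBₚ 3 0 2 W₁) refl

gCoeff-polyB : ∀ k → gCoeff k ≡ shift 1 (polyB 4 W₁) k
gCoeff-polyB zero = refl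
gCoeff-polyB (suc m) = begin
  gCoeff (suc m)
    ≡⟨ gCoeff-factorialRatio 0 m ⟩
  gₚ 0 at ⟦ m ⟧ * factorialRatio 3 2 6 m
    ≡⟨ cong (_* factorialRatio 3 2 6 m) (g-identity ⟦ m ⟧) ⟩
  polyBₚ 3 0 2 W₁ at ⟦ m ⟧ * factorialRatio 3 2 6 m
    ≡⟨ sym (polyB-factorialRatio 3 0 2 W₁ m) ⟩
  polyB 4 W₁ m ∎

gPowCoeff-polyB : ∀ r n → gPowCoeff r n ≡ shift r (polyB (4 ℕ.* r) (W₁ ^ᴸ r)) n
gPowCoeff-polyB zero zero = refl
gPowCoeff-polyB zero (suc n) = refl
gPowCoeff-polyB (suc r) n = begin
  (gCoeff ⋆ gPowCoeff r) n
    ≡⟨ ⋆-cong gCoeff-polyB (gPowCoeff-polyB r) n ⟩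
  (shift 1 (polyB 4 W₁) ⋆ shift r (polyB (4 ℕ.* r) (W₁ ^ᴸ r))) n
    ≡⟨ shift-⋆-shift r (polyB 4 W₁) (polyB (4 ℕ.* r) (W₁ ^ᴸ r)) n ⟩
  shift (suc r) (polyB 4 W₁ ⋆ polyB (4 ℕ.* r) (W₁ ^ᴸ r)) n
    ≡⟨ shift-cong (suc r) (λ k → trans (polyB-⋆ 4 (4 ℕ.* r) W₁ (W₁ ^ᴸ r) k)
                                       (cong (λ a → polyB a (W₁ ^ᴸ suc r) k) (sym (ℕP.*-suc 4 r)))) n ⟩
  shift (suc r) (polyB (4 ℕ.* suc r) (W₁ ^ᴸ suc r)) n ∎

A-closed-form : ∀ r m →
  A (suc r) (suc r ℕ.+ m) ≡ polyBₚ (4 ℕ.* r ℕ.+ 3) 0 (r ℕ.+ 2) (W₁ ^ᴸ suc r) at ⟦ m ⟧ ÷' gₚ r at ⟦ m ⟧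
A-closed-form r m = begin
  gPowCoeff (suc r) (suc r ℕ.+ m) ÷' gCoeff (suc r ℕ.+ m)
    ≡⟨ cong₂ _÷'_ numerator (gCoeff-factorialRatio r m) ⟩
  (P * ratio) ÷' (gₚ r at ⟦ m ⟧ * ratio)
    ≡⟨ ÷'-cancelʳ P (gₚ r at ⟦ m ⟧) ratio
         (subst (_≢ 0ℚ) (gCoeff-factorialRatio r m) (gCoeff≢0 (r ℕ.+ m))) ⟩
  P ÷' gₚ r at ⟦ m ⟧ ∎
  where
  a = 4 ℕ.* r ℕ.+ 3
  W = W₁ ^ᴸ suc r
  P = polyBₚ a 0 (r ℕ.+ 2) W at ⟦ m ⟧
  ratio = factorialRatio a (r ℕ.+ 2) (6 ℕ.* r ℕ.+ 6) m
  index₁ : ∀ r → 4 ℕ.* suc r ≡ suc (4 ℕ.* r ℕ.+ 3 ℕ.+ 0)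
  index₁ = ℕ-Solver.solve-∀
  index₂ : ∀ r → 4 ℕ.* r ℕ.+ 3 ℕ.+ 0 ℕ.+ suc (2 ℕ.* suc r) ≡ 6 ℕ.* r ℕ.+ 6
  index₂ = ℕ-Solver.solve-∀
  numerator : gPowCoeff (suc r) (suc r ℕ.+ m) ≡ P * ratio
  numerator = begin
    gPowCoeff (suc r) (suc r ℕ.+ m)
      ≡⟨ gPowCoeff-polyB (suc r) (suc r ℕ.+ m) ⟩
    shift (suc r) (polyB (4 ℕ.* suc r) W) (suc r ℕ.+ m)
      ≡⟨ shift-+ (suc r) (polyB (4 ℕ.* suc r) W) m ⟩
    polyB (4 ℕ.* suc r) W m
      ≡⟨ cong (λ b → polyB b W m) (index₁ r) ⟩
    polyB (suc (a ℕ.+ 0)) W m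
      ≡⟨ polyB-factorialRatio a 0 (r ℕ.+ 2) W m ⟩
    P * factorialRatio a (r ℕ.+ 2) (a ℕ.+ 0 ℕ.+ length W) m
      ≡⟨ cong (λ c → P * factorialRatio a (r ℕ.+ 2) c m) (trans (cong (a ℕ.+ 0 ℕ.+_) (length-W₁^ᴸ (suc r))) (index₂ r)) ⟩
    P * ratio ∎

-- The exact formulas

A-below : ∀ r n → n ℕ.< r → A r n ≡ 0ℚ
A-below r n n<r = trans (cong (_÷' gCoeff n) (trans (gPowCoeff-polyB r n) (shift-below r _ n n<r))) (0÷' (gCoeff n))

Num₃ Den₃ : Polynomial 1 → Polynomial 1
Num₃ y = ‵ 5 :* (y :- ‵ 1) :* (y :- ‵ 2)
         :* (‵ 5 :* y :* y :* y :* y :+ ‵ 160 :* y :* y :* y :+ ‵ 1803 :* y :* y :+ ‵ 3768 :* y :+ ‵ 2016)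
Den₃ y = ‵ 3 :* (‵ 3 :* y :+ ‵ 8) :* (‵ 3 :* y :+ ‵ 5) :* (‵ 3 :* y :+ ‵ 7) :* (‵ 3 :* y :+ ‵ 4) :* (y :+ ‵ 3) :* (y :+ ‵ 2)

A3formula-at : ∀ n → A3formula n ≡ Num₃ X at ⟦ n ⟧ ÷' Den₃ X at ⟦ n ⟧
A3formula-at n = refl

A₃-identity : ∀ x → polyBₚ 11 0 4 (W₁ ^ᴸ 3) at x * Den₃ (‵ 3 :+ X) at x ≡ Num₃ (‵ 3 :+ X) at x * gₚ 2 at x
A₃-identity x = prove (x ∷ []) (polyBₚ 11 0 4 (W₁ ^ᴸ 3) :* Den₃ (‵ 3 :+ X)) (Num₃ (‵ 3 :+ X) :* gₚ 2) refl

Den₃-pos : ∀ {y} → 0ℚ ≤ y → 0ℚ < Den₃ X at y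
Den₃-pos 0≤y = 0<⟦suc⟧ 2 ·⁺ affine-pos 3 7 0≤y ·⁺ affine-pos 3 4 0≤y ·⁺ affine-pos 3 6 0≤y ·⁺ affine-pos 3 3 0≤y
               ·⁺ +⟦suc⟧-pos 2 0≤y ·⁺ +⟦suc⟧-pos 1 0≤y

A₃-exact : ∀ n → 1 ℕ.≤ n → A 3 n ≡ A3formula n
A₃-exact 1 _ = A-below 3 1 (s≤s (s≤s z≤n))
A₃-exact 2 _ = A-below 3 2 (s≤s (s≤s (s≤s z≤n)))
A₃-exact (suc (suc (suc m))) _ = begin
  A 3 (3 ℕ.+ m)
    ≡⟨ A-closed-form 2 m ⟩
  polyBₚ 11 0 4 (W₁ ^ᴸ 3) at ⟦ m ⟧ ÷' gₚ 2 at ⟦ m ⟧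
    ≡⟨ ÷'-cross (gₚ≢0 2 m) (pos⇒≢0 (Den₃-pos 0≤3+m)) (A₃-identity ⟦ m ⟧) ⟩
  Num₃ X at (⟦ 3 ⟧ + ⟦ m ⟧) ÷' Den₃ X at (⟦ 3 ⟧ + ⟦ m ⟧)
    ≡⟨ cong (λ y → Num₃ X at y ÷' Den₃ X at y) (sym (⟦⟧-+ 3 m)) ⟩
  Num₃ X at ⟦ 3 ℕ.+ m ⟧ ÷' Den₃ X at ⟦ 3 ℕ.+ m ⟧
    ≡⟨ sym (A3formula-at (3 ℕ.+ m)) ⟩
  A3formula (3 ℕ.+ m) ∎
  where
  0≤3+m = subst (0ℚ ≤_) (⟦⟧-+ 3 m) (⟦⟧-nonNeg (3 ℕ.+ m))

Num₄ Den₄ : Polynomial 1 → Polynomial 1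
Num₄ y = ‵ 20 :* (y :- ‵ 1) :* (y :- ‵ 2) :* (y :- ‵ 3)
         :* (‵ 25 :* y :* y :* y :* y :* y :* y :+ ‵ 1350 :* y :* y :* y :* y :* y :+ ‵ 31495 :* y :* y :* y :* y
             :+ ‵ 347406 :* y :* y :* y :+ ‵ 1211092 :* y :* y :+ ‵ 1580304 :* y :+ ‵ 665280)
Den₄ y = ‵ 27 :* (‵ 3 :* y :+ ‵ 11) :* (‵ 3 :* y :+ ‵ 8) :* (‵ 3 :* y :+ ‵ 5) :* (‵ 3 :* y :+ ‵ 10)
         :* (‵ 3 :* y :+ ‵ 7) :* (‵ 3 :* y :+ ‵ 4) :* (y :+ ‵ 4) :* (y :+ ‵ 3) :* (y :+ ‵ 2)

A4formula-at : ∀ n → A4formula n ≡ Num₄ X at ⟦ n ⟧ ÷' Den₄ X at ⟦ n ⟧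
A4formula-at n = refl

A₄-identity : ∀ x → polyBₚ 15 0 5 (W₁ ^ᴸ 4) at x * Den₄ (‵ 4 :+ X) at x ≡ Num₄ (‵ 4 :+ X) at x * gₚ 3 at x
A₄-identity x = prove (x ∷ []) (polyBₚ 15 0 5 (W₁ ^ᴸ 4) :* Den₄ (‵ 4 :+ X)) (Num₄ (‵ 4 :+ X) :* gₚ 3) refl

Den₄-pos : ∀ {y} → 0ℚ ≤ y → 0ℚ < Den₄ X at y
Den₄-pos 0≤y = 0<⟦suc⟧ 26 ·⁺ affine-pos 3 10 0≤y ·⁺ affine-pos 3 7 0≤y ·⁺ affine-pos 3 4 0≤y ·⁺ affine-pos 3 9 0≤y
               ·⁺ affine-pos 3 6 0≤y ·⁺ affine-pos 3 3 0≤y ·⁺ +⟦suc⟧-pos 3 0≤y ·⁺ +⟦suc⟧-pos 2 0≤y ·⁺ +⟦suc⟧-pos 1 0≤y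

A₄-exact : ∀ n → 1 ℕ.≤ n → A 4 n ≡ A4formula n
A₄-exact 1 _ = A-below 4 1 (s≤s (s≤s z≤n))
A₄-exact 2 _ = A-below 4 2 (s≤s (s≤s (s≤s z≤n)))
A₄-exact 3 _ = A-below 4 3 (s≤s (s≤s (s≤s (s≤s z≤n))))
A₄-exact (suc (suc (suc (suc m)))) _ = begin
  A 4 (4 ℕ.+ m)
    ≡⟨ A-closed-form 3 m ⟩
  polyBₚ 15 0 5 (W₁ ^ᴸ 4) at ⟦ m ⟧ ÷' gₚ 3 at ⟦ m ⟧
    ≡⟨ ÷'-cross (gₚ≢0 3 m) (pos⇒≢0 (Den₄-pos 0≤4+m)) (A₄-identity ⟦ m ⟧) ⟩
  Num₄ X at (⟦ 4 ⟧ + ⟦ m ⟧) ÷' Den₄ X at (⟦ 4 ⟧ + ⟦ m ⟧)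
    ≡⟨ cong (λ y → Num₄ X at y ÷' Den₄ X at y) (sym (⟦⟧-+ 4 m)) ⟩
  Num₄ X at ⟦ 4 ℕ.+ m ⟧ ÷' Den₄ X at ⟦ 4 ℕ.+ m ⟧
    ≡⟨ sym (A4formula-at (4 ℕ.+ m)) ⟩
  A4formula (4 ℕ.+ m) ∎
  where
  0≤4+m = subst (0ℚ ≤_) (⟦⟧-+ 4 m) (⟦⟧-nonNeg (4 ℕ.+ m))

-- The limits

hornerₚ : List ℕ → Polynomial 1
hornerₚ [] = ‵ 0
hornerₚ (c ∷ cs) = ‵ c :+ X :* hornerₚ cs

hornerₚ-nonNeg : ∀ cs {t} → 0ℚ ≤ t → 0ℚ ≤ hornerₚ cs at t
hornerₚ-nonNeg [] 0≤t = ℚP.≤-refl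
hornerₚ-nonNeg (c ∷ cs) 0≤t = ℚP.+-mono-≤ (⟦⟧-nonNeg c) (*-nonNeg 0≤t (hornerₚ-nonNeg cs 0≤t))

-- The last two hypotheses say that K/x ∓ (N(x)/D(x) - c₁/c₂), multiplied by x c₂ D(x) and written in
-- t = x - 1, are polynomials whose coefficients S₁, S₂ are natural numbers.
rational-limit-bound : ∀ (N D : ℚ → ℚ) c₁ c₂ K (S₁ S₂ : List ℕ) .{{_ : ℕ.NonZero c₂}} →
  (∀ {y} → 0ℚ ≤ y → 0ℚ < D y) →
  (∀ t → ⟦ K ⟧ * ⟦ c₂ ⟧ * D (t + ⟦ 1 ⟧) - (t + ⟦ 1 ⟧) * (⟦ c₂ ⟧ * N (t + ⟦ 1 ⟧) - ⟦ c₁ ⟧ * D (t + ⟦ 1 ⟧))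
         ≡ hornerₚ S₁ at t) →
  (∀ t → ⟦ K ⟧ * ⟦ c₂ ⟧ * D (t + ⟦ 1 ⟧) + (t + ⟦ 1 ⟧) * (⟦ c₂ ⟧ * N (t + ⟦ 1 ⟧) - ⟦ c₁ ⟧ * D (t + ⟦ 1 ⟧))
         ≡ hornerₚ S₂ at t) →
  ∀ k → ∣ N ⟦ suc k ⟧ ÷' D ⟦ suc k ⟧ - ⟦ c₁ ⟧ ÷' ⟦ c₂ ⟧ ∣ ≤ ⟦ K ⟧ ÷' ⟦ suc k ⟧
rational-limit-bound N D c₁ c₂ K S₁ S₂ D-pos S₁-identity S₂-identity k = 0≤q∓p⇒∣p∣≤q upper lower
  where
  x = ⟦ suc k ⟧
  c = ⟦ c₂ ⟧
  c≢0 : c ≢ 0ℚ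
  c≢0 = ⟦⟧-nonZero c₂ (ℕ.≢-nonZero⁻¹ c₂)
  P = x * c * D x
  P-pos : 0ℚ < P
  P-pos = 0<⟦suc⟧ k ·⁺ ℚP.positive⁻¹ c {{ℚP.normalize-pos c₂ 1}} ·⁺ D-pos (⟦⟧-nonNeg (suc k))
  B = ⟦ K ⟧ ÷' x
  d = N x ÷' D x - ⟦ c₁ ⟧ ÷' c
  BP : B * P ≡ ⟦ K ⟧ * c * D x
  BP = trans (regroup B x c (D x)) (cong (λ y → y * c * D x) (÷'-*-cancel ⟦ K ⟧ x (⟦suc⟧≢0 k)))
    where
    regroup : ∀ b x c d → b * (x * c * d) ≡ b * x * c * d
    regroup = solve-∀ ℚ-ring
  dP : d * P ≡ x * (c * N x - ⟦ c₁ ⟧ * D x)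
  dP = trans (regroup (N x ÷' D x) (⟦ c₁ ⟧ ÷' c) x c (D x))
             (cong₂ (λ y z → x * (c * y - z * D x))
                    (÷'-*-cancel (N x) (D x) (pos⇒≢0 (D-pos (⟦⟧-nonNeg (suc k))))) (÷'-*-cancel ⟦ c₁ ⟧ c c≢0))
    where
    regroup : ∀ v w x c d → (v - w) * (x * c * d) ≡ x * (c * (v * d) - w * c * d)
    regroup = solve-∀ ℚ-ring
  Q Δ : ℚ → ℚ
  Q y = ⟦ K ⟧ * c * D y
  Δ y = y * (c * N y - ⟦ c₁ ⟧ * D y)
  upper : 0ℚ ≤ B - d
  upper = 0≤p*q⇒0≤p P-pos (subst (0ℚ ≤_) (sym (begin
    (B - d) * P               ≡⟨ distrib B d P ⟩
    B * P - d * P             ≡⟨ cong₂ _-_ BP dP ⟩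
    Q x - Δ x                 ≡⟨ cong (λ y → Q y - Δ y) (⟦suc⟧≡+1 k) ⟩
    Q (⟦ k ⟧ + ⟦ 1 ⟧) - Δ (⟦ k ⟧ + ⟦ 1 ⟧) ≡⟨ S₁-identity ⟦ k ⟧ ⟩
    hornerₚ S₁ at ⟦ k ⟧       ∎)) (hornerₚ-nonNeg S₁ (⟦⟧-nonNeg k)))
    where
    distrib : ∀ b d p → (b - d) * p ≡ b * p - d * p
    distrib = solve-∀ ℚ-ring
  lower : 0ℚ ≤ B + d
  lower = 0≤p*q⇒0≤p P-pos (subst (0ℚ ≤_) (sym (begin
    (B + d) * P               ≡⟨ ℚP.*-distribʳ-+ P B d ⟩
    B * P + d * P             ≡⟨ cong₂ _+_ BP dP ⟩
    Q x + Δ x                 ≡⟨ cong (λ y → Q y + Δ y) (⟦suc⟧≡+1 k) ⟩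
    Q (⟦ k ⟧ + ⟦ 1 ⟧) + Δ (⟦ k ⟧ + ⟦ 1 ⟧) ≡⟨ S₂-identity ⟦ k ⟧ ⟩
    hornerₚ S₂ at ⟦ k ⟧       ∎)) (hornerₚ-nonNeg S₂ (⟦⟧-nonNeg k)))

-- ε ≥ 1/↧ε, so K ≤ k/↧ε < ε (k + 1)
⟦⟧<ε*⟦suc⟧ : ∀ K k ε → 0ℚ < ε → K ℕ.* ℚ.↧ₙ ε ℕ.≤ k → ⟦ K ⟧ < ε * ⟦ suc k ⟧
⟦⟧<ε*⟦suc⟧ K k (mkℚ (+ zero) d _) (ℚ.*<* (ℤ.+<+ ()))
⟦⟧<ε*⟦suc⟧ K k (mkℚ ℤ.-[1+ n ] d _) (ℚ.*<* ())
⟦⟧<ε*⟦suc⟧ K k ε@(mkℚ (+ suc p) d _) _ K*den≤k =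
  ℚP.toℚᵘ-cancel-< (ℚᵘP.<-respˡ-≃ (ℚᵘP.≃-sym (ι-toℚᵘ (+ K))) (ℚᵘP.<-respʳ-≃ (ℚᵘP.≃-sym toℚᵘ-ε*x) (ℚᵘ.*<* ℤ-ineq)))
  where
  toℚᵘ-ε*x : ℚ.toℚᵘ (ε * ⟦ suc k ⟧) ℚᵘ.≃ ℚᵘ.mkℚᵘ (+ suc p) d ℚᵘ.* ℚᵘ.mkℚᵘ (+ suc k) 0
  toℚᵘ-ε*x = ℚᵘP.≃-trans (ℚP.toℚᵘ-homo-* ε ⟦ suc k ⟧) (ℚᵘP.*-congˡ {ℚᵘ.mkℚᵘ (+ suc p) d} (ι-toℚᵘ (+ suc k)))
  ℕ-ineq : K ℕ.* suc d ℕ.< suc p ℕ.* suc k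
  ℕ-ineq = ℕP.≤-<-trans K*den≤k (ℕP.<-≤-trans (ℕP.n<1+n k) (ℕP.m≤n*m (suc k) (suc p)))
  ℤ-ineq : + K ℤ.* + (suc d ℕ.* 1) ℤ.< + (suc p) ℤ.* + (suc k) ℤ.* + 1
  ℤ-ineq = subst₂ ℤ._<_ (trans (ℤP.pos-* K (suc d)) (cong (λ n → + K ℤ.* + n) (sym (ℕP.*-identityʳ (suc d)))))
                        (trans (ℤP.pos-* (suc p) (suc k)) (sym (ℤP.*-identityʳ (+ suc p ℤ.* + suc k))))
                        (ℤ.+<+ ℕ-ineq)

bound⇒convergesTo : ∀ (a : ℕ → ℚ) L K → (∀ k → ∣ a (suc k) - L ∣ ≤ ⟦ K ⟧ ÷' ⟦ suc k ⟧) → ConvergesTo a L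
bound⇒convergesTo a L K bound ε 0<ε = suc (K ℕ.* ℚ.↧ₙ ε) , tail
  where
  tail : ∀ n → suc (K ℕ.* ℚ.↧ₙ ε) ℕ.≤ n → ∣ a n - L ∣ < ε
  tail (suc k) (s≤s K*den≤k) = ℚP.≤-<-trans (bound k) (ℚP.*-cancelʳ-<-nonNeg x {{ℚ.nonNegative (⟦⟧-nonNeg (suc k))}}
    (subst (_< ε * x) (sym (÷'-*-cancel ⟦ K ⟧ x (⟦suc⟧≢0 k))) (⟦⟧<ε*⟦suc⟧ K k ε 0<ε K*den≤k)))
    where
    x = ⟦ suc k ⟧

A₃-bound : ∀ k → ∣ A 3 (suc k) - ⟦ 25 ⟧ ÷' ⟦ 243 ⟧ ∣ ≤ ⟦ 2 ⟧ ÷' ⟦ suc k ⟧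
A₃-bound k = subst (λ a → ∣ a - ⟦ 25 ⟧ ÷' ⟦ 243 ⟧ ∣ ≤ ⟦ 2 ⟧ ÷' ⟦ suc k ⟧) (sym (A₃-exact (suc k) (s≤s z≤n)))
  (rational-limit-bound (Num₃ X at_) (Den₃ X at_) 25 243 2 S₁ S₂ Den₃-pos
    (λ t → prove (t ∷ []) (‵ 2 :* ‵ 243 :* Den₃ y :- y :* (‵ 243 :* Num₃ y :- ‵ 25 :* Den₃ y)) (hornerₚ S₁) refl)
    (λ t → prove (t ∷ []) (‵ 2 :* ‵ 243 :* Den₃ y :+ y :* (‵ 243 :* Num₃ y :- ‵ 25 :* Den₃ y)) (hornerₚ S₂) refl)
    k)
  where
  y = X :+ ‵ 1
  S₁ S₂ : List ℕ
  S₁ = 113319360 ∷ 237026928 ∷ 200488092 ∷ 79532850 ∷ 12992130 ∷ 462942 ∷ 20898 ∷ []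
  S₂ = 102231360 ∷ 185373168 ∷ 142007772 ∷ 67564770 ∷ 22306050 ∷ 4024782 ∷ 215298 ∷ []

A₄-bound : ∀ k → ∣ A 4 (suc k) - ⟦ 500 ⟧ ÷' ⟦ 19683 ⟧ ∣ ≤ ⟦ 1 ⟧ ÷' ⟦ suc k ⟧
A₄-bound k = subst (λ a → ∣ a - ⟦ 500 ⟧ ÷' ⟦ 19683 ⟧ ∣ ≤ ⟦ 1 ⟧ ÷' ⟦ suc k ⟧) (sym (A₄-exact (suc k) (s≤s z≤n)))
  (rational-limit-bound (Num₄ X at_) (Den₄ X at_) 500 19683 1 S₁ S₂ Den₄-pos
    (λ t → prove (t ∷ []) (‵ 1 :* ‵ 19683 :* Den₄ y :- y :* (‵ 19683 :* Num₄ y :- ‵ 500 :* Den₄ y)) (hornerₚ S₁) refl)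
    (λ t → prove (t ∷ []) (‵ 1 :* ‵ 19683 :* Den₄ y :+ y :* (‵ 19683 :* Num₄ y :- ‵ 500 :* Den₄ y)) (hornerₚ S₂) refl)
    k)
  where
  y = X :+ ‵ 1
  S₁ S₂ : List ℕ
  S₁ = 36656655235200 ∷ 93366310761360 ∷ 109456505030412 ∷ 78737350273344 ∷ 35869310835273
       ∷ 9497949017121 ∷ 1256801016978 ∷ 69973891686 ∷ 3827798937 ∷ 151224489 ∷ []
  S₂ = 34840440835200 ∷ 92861244458640 ∷ 104424616636812 ∷ 63441806943744 ∷ 24427637462313
       ∷ 7422368210721 ∷ 1885437429138 ∷ 302466338406 ∷ 21741953337 ∷ 623616489 ∷ []

mainTheorem5 : ((n : ℕ) → 1 ℕ.≤ n → A 3 n ≡ A3formula n × A 4 n ≡ A4formula n)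
               × ConvergesTo (A 3) (⟦ 25 ⟧ ÷' ⟦ 243 ⟧)
               × ConvergesTo (A 4) (⟦ 500 ⟧ ÷' ⟦ 19683 ⟧)
mainTheorem5 = (λ n 1≤n → A₃-exact n 1≤n , A₄-exact n 1≤n)
             , bound⇒convergesTo (A 3) (⟦ 25 ⟧ ÷' ⟦ 243 ⟧) 2 A₃-bound
             , bound⇒convergesTo (A 4) (⟦ 500 ⟧ ÷' ⟦ 19683 ⟧) 1 A₄-bound
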